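{- Let $n\ge1$ and $0\le k\le n-1$ be integers and $N=2n-k$. For $T\in\mathrm{Inc}^k(2\times n)$, process the entries $i$ of row 2 of $T$ in increasing order and let $s_i$ be the largest entry of row 1 of $T$ that is less than $i$ and is not equal to $s_j$ for any already processed $j<i$; let $\pi(T)$ be the partition of $\{1,\dots,N\}$ generated by declaring $i$ and $s_i$ to be in the same block for every $i$ in row 2. Then $\pi$ is a bijection from $\mathrm{Inc}^k(2\times n)$ onto the set of noncrossing partitions of $\{1,\dots,N\}$ into exactly $n-k$ blocks, all of size at least $2$.
   Context: Partitions are identified with Young diagrams in English convention; $|\lambda|$ is the number of boxes; $2\times n$ is the partition $(n,n)$. An increasing tableau of shape $\lambda$ is a filling of the boxes of $\lambda$ by positive integers, strictly increasing along rows and down columns, whose set of entries is $\{1,\dots,M\}$ for some $M$. $\mathrm{Inc}^k(\lambda)$ is the set of increasing tableaux of shape $\lambda$ with maximum entry $|\lambda|-k$. A set partition of $\{1,\dots,N\}$ is noncrossing if, when $1,\dots,N$ are placed equally spaced around a circle, the convex hulls of its blocks are pairwise disjoint; equivalently, there are no $a<b<c<d$ with $a,c$ in one block and $b,d$ in a different block. -}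

module Defs where

open import Data.Nat using (ℕ; zero; suc; _+_; _*_; _∸_; _≤_; _<_; _⊔_; _≟_; _<?_)
open import Data.Fin using (Fin)
open import Data.Vec using (Vec; toList) renaming (lookup to vlookup)
open import Data.List using (List; []; _∷_; length; lookup)
open import Data.List.Membership.Propositional using (_∈_)
open import Data.List.Relation.Unary.All using (All)
open import Data.List.Relation.Unary.Any using (Any)
open import Data.List.Relation.Unary.Linked using (Linked)
open import Data.Maybe using (Maybe; just; nothing)
open import Data.Product using (Σ; ∃; _×_; _,_)
open import Data.Sum using (_⊎_)
open import Relation.Nullary using (¬_; yes; no)
open import Relation.Binary.PropositionalEquality using (_≡_; _≢_)

-- Increasing tableaux of shape 2 × n.
-- A tableau is a pair (row1 , row2) of vectors of length n;
-- column j has top entry row1[j] and bottom entry row2[j].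

Tab : ℕ → Set
Tab n = Vec ℕ n × Vec ℕ n

StrictlyIncreasing : ∀ {n} → Vec ℕ n → Set
StrictlyIncreasing {n} v = (i j : Fin n) → Data.Fin._<_ i j → vlookup v i < vlookup v j

IsIncreasingTableau : ∀ {n} → ℕ → Tab n → Set
IsIncreasingTableau {n} M (r1 , r2) =
  StrictlyIncreasing r1 × StrictlyIncreasing r2 ×
  ((j : Fin n) → vlookup r1 j < vlookup r2 j) ×
  ((j : Fin n) → (1 ≤ vlookup r1 j × vlookup r1 j ≤ M) × (1 ≤ vlookup r2 j × vlookup r2 j ≤ M)) ×
  ((m : ℕ) → 1 ≤ m → m ≤ M → (m ∈ toList r1) ⊎ (m ∈ toList r2))

InInc : (k n : ℕ) → Tab n → Set
InInc k n T = IsIncreasingTableau (2 * n ∸ k) T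

largestBelow : ℕ → List ℕ → Maybe ℕ
largestBelow i [] = nothing
largestBelow i (x ∷ xs) with x <? i | largestBelow i xs
... | yes _ | nothing = just x
... | yes _ | just y  = just (x ⊔ y)
... | no _  | r       = r

remove : ℕ → List ℕ → List ℕ
remove s [] = []
remove s (x ∷ xs) with x ≟ s
... | yes _ = remove s xs
... | no _  = x ∷ remove s xs

-- pairingFrom avail is: process the row-2 entries is (in the given order);
-- avail = row-1 entries not yet used as some s_j.
pairingFrom : List ℕ → List ℕ → Maybe (List (ℕ × ℕ))
pairingFrom avail [] = just []
pairingFrom avail (i ∷ is) with largestBelow i avail
... | nothing = nothing
... | just s with pairingFrom (remove s avail) is
...   | nothing = nothing
...   | just ps = just ((i , s) ∷ ps)

-- row 2 is strictly increasing, so its left-to-right order is increasing order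
pairing : ∀ {n} → Tab n → Maybe (List (ℕ × ℕ))
pairing (r1 , r2) = pairingFrom (toList r1) (toList r2)

-- Set partitions of {1, ..., N}, in canonical form: a list of blocks,
-- each block a nonempty strictly increasing list, blocks ordered by
-- their minima, pairwise disjoint, with union {1, ..., N}.

SetPartition : Set
SetPartition = List (List ℕ)

head0 : List ℕ → ℕ
head0 [] = 0
head0 (x ∷ _) = x

NonEmpty : List ℕ → Set
NonEmpty [] = Data.Empty.⊥ where import Data.Empty
NonEmpty (_ ∷ _) = Data.Unit.⊤ where import Data.Unit

IsSetPartition : ℕ → SetPartition → Set
IsSetPartition N P =
  All NonEmpty P ×
  All (Linked _<_) P ×
  Linked (λ B B' → head0 B < head0 B') P ×
  ((i j : Fin (length P)) (x : ℕ) → x ∈ lookup P i → x ∈ lookup P j → i ≡ j) ×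
  ((x : ℕ) → (1 ≤ x × x ≤ N) → Any (x ∈_) P) ×
  ((x : ℕ) → Any (x ∈_) P → 1 ≤ x × x ≤ N)

SameBlock : SetPartition → ℕ → ℕ → Set
SameBlock P x y = Any (λ B → x ∈ B × y ∈ B) P

data Conn (E : List (ℕ × ℕ)) : ℕ → ℕ → Set where
  c-refl  : ∀ {x} → Conn E x x
  c-edge  : ∀ {x y} → (x , y) ∈ E → Conn E x y
  c-sym   : ∀ {x y} → Conn E x y → Conn E y x
  c-trans : ∀ {x y z} → Conn E x y → Conn E y z → Conn E x z

Generates : ℕ → List (ℕ × ℕ) → SetPartition → Set
Generates N E P =
  (x y : ℕ) → 1 ≤ x → x ≤ N → 1 ≤ y → y ≤ N →
  (SameBlock P x y → Conn E x y) × (Conn E x y → SameBlock P x y)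

Noncrossing : SetPartition → Set
Noncrossing P =
  (i j : Fin (length P)) → i ≢ j → (a b c d : ℕ) → a < b → b < c → c < d →
  a ∈ lookup P i → c ∈ lookup P i → b ∈ lookup P j → d ∈ lookup P j →
  Data.Empty.⊥
  where import Data.Empty

InNC : (N m : ℕ) → SetPartition → Set
InNC N m P =
  IsSetPartition N P × Noncrossing P × length P ≡ m × All (λ B → 2 ≤ length B) P

PiRel : (k n : ℕ) → Tab n → SetPartition → Set
PiRel k n T P =
  IsSetPartition (2 * n ∸ k) P ×
  Σ (List (ℕ × ℕ)) (λ E → pairing T ≡ just E × Generates (2 * n ∸ k) E P)

record IsBijectionRel {X Y : Set} (A : X → Set) (B : Y → Set) (R : X → Y → Set) : Set where
  field
    total      : (x : X) → A x → Σ Y (λ y → B y × R x y)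
    functional : (x : X) (y y' : Y) → A x → R x y → R x y' → y ≡ y'
    injective  : (x x' : X) (y : Y) → A x → A x' → R x y → R x' y → x ≡ x'
    surjective : (y : Y) → B y → Σ X (λ x → A x × R x y)

module Submission where

-- For rows r1, r2 of T the pairing sends i ∈ r2 to p i = s_i ∈ r1, with p
-- injective, p i < i, and onto r1 (both rows have n entries).  So p is a
-- forest of chains and π(T) is the partition into its trees: one block per
-- point outside r2, i.e. n - k blocks, each of size ≥ 2; greedy maximality
-- of s_i forbids crossing trees.  Conversely, P determines r1 (points with a
-- larger blockmate), r2 (with a smaller one) and p (largest smaller
-- blockmate): counting gives |r1| = |r2| = n, injectivity of p the column
-- condition, noncrossingness the greedy property, so P = π(T).

open import Defs
open import Data.Nat using (ℕ; _≤_; _<_; _*_; _∸_)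

module SortedLists where

  open import Data.Nat
  open import Data.Nat.Properties
  open import Data.List using (List; []; _∷_; length; map; filter; applyUpTo; take; drop)
  open import Data.List.Properties using (length-applyUpTo; length-take; length-map)
  open import Data.List.Membership.Propositional using (_∈_)
  open import Data.List.Membership.Propositional.Properties using (∈-applyUpTo⁺; ∈-applyUpTo⁻; ∈-filter⁺; ∈-filter⁻; ∈-map⁻)
  open import Data.List.Membership.DecPropositional _≟_ using (_∈?_)
  open import Data.List.Relation.Unary.All as All using (All; []; _∷_)
  open import Data.List.Relation.Unary.All.Properties as Allₚ using ()
  open import Data.List.Relation.Unary.Any using (here; there)
  open import Data.List.Relation.Unary.AllPairs as AllPairs using (AllPairs; []; _∷_)
  open import Data.List.Relation.Unary.AllPairs.Properties as AllPairsₚ using (applyUpTo⁺₁)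
  open import Data.Product using (Σ; _×_; _,_; proj₂)
  open import Data.Sum using (inj₁; inj₂)
  open import Data.Empty using (⊥-elim)
  open import Relation.Nullary using (yes; no; ¬?)
  open import Relation.Unary using (Decidable)
  open import Relation.Binary.PropositionalEquality

  Sorted : List ℕ → Set
  Sorted = AllPairs _<_

  Distinct : List ℕ → Set
  Distinct = AllPairs _≢_

  sorted⇒distinct : ∀ {xs} → Sorted xs → Distinct xs
  sorted⇒distinct = AllPairs.map <⇒≢

  range : ℕ → List ℕ
  range = applyUpTo suc

  ∈-range⁺ : ∀ {x N} → 1 ≤ x → x ≤ N → x ∈ range N
  ∈-range⁺ {suc x} _ x≤N = ∈-applyUpTo⁺ suc x≤N

  ∈-range⁻ : ∀ {x N} → x ∈ range N → 1 ≤ x × x ≤ N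
  ∈-range⁻ m with ∈-applyUpTo⁻ suc m
  ... | _ , i<N , refl = s≤s z≤n , i<N

  range-sorted : ∀ N → Sorted (range N)
  range-sorted N = applyUpTo⁺₁ suc N (λ i<j _ → s≤s i<j)

  length-range : ∀ N → length (range N) ≡ N
  length-range = length-applyUpTo suc

  sorted-ext : ∀ {xs ys} → Sorted xs → Sorted ys →
    (∀ {x} → x ∈ xs → x ∈ ys) → (∀ {x} → x ∈ ys → x ∈ xs) → xs ≡ ys
  sorted-ext {[]} {[]} _ _ _ _ = refl
  sorted-ext {[]} {y ∷ ys} _ _ _ ys⊆xs with ys⊆xs (here refl)
  ... | ()
  sorted-ext {x ∷ xs} {[]} _ _ xs⊆ys _ with xs⊆ys (here refl)
  ... | ()
  sorted-ext {x ∷ xs} {y ∷ ys} (x< ∷ sxs) (y< ∷ sys) xs⊆ys ys⊆xs =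
    cong₂ _∷_ x≡y (sorted-ext sxs sys tail⊆ tail⊇)
    where
    x≡y : x ≡ y
    x≡y with xs⊆ys (here refl) | ys⊆xs (here refl)
    ... | here e  | _       = e
    ... | there _ | here e  = sym e
    ... | there a | there b = ⊥-elim (<-asym (All.lookup y< a) (All.lookup x< b))
    tail⊆ : ∀ {z} → z ∈ xs → z ∈ ys
    tail⊆ m with xs⊆ys (there m)
    ... | here e   = ⊥-elim (<-irrefl (trans x≡y (sym e)) (All.lookup x< m))
    ... | there m' = m'
    tail⊇ : ∀ {z} → z ∈ ys → z ∈ xs
    tail⊇ m with ys⊆xs (there m)
    ... | here e   = ⊥-elim (<-irrefl (trans (sym x≡y) (sym e)) (All.lookup y< m))
    ... | there m' = m'

  delete : ∀ {x} (ys : List ℕ) → x ∈ ys → List ℕ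
  delete (y ∷ ys) (here _)  = ys
  delete (y ∷ ys) (there m) = y ∷ delete ys m

  length-delete : ∀ {x} (ys : List ℕ) (m : x ∈ ys) → length ys ≡ suc (length (delete ys m))
  length-delete (y ∷ ys) (here _)  = refl
  length-delete (y ∷ ys) (there m) = cong suc (length-delete ys m)

  ∈-delete : ∀ {x z} (ys : List ℕ) (m : x ∈ ys) → z ∈ ys → z ≢ x → z ∈ delete ys m
  ∈-delete (y ∷ ys) (here refl) (here refl) z≢x = ⊥-elim (z≢x refl)
  ∈-delete (y ∷ ys) (here refl) (there zm)  _   = zm
  ∈-delete (y ∷ ys) (there m)   (here refl) _   = here refl
  ∈-delete (y ∷ ys) (there m)   (there zm)  z≢x = there (∈-delete ys m zm z≢x)

  distinct-⊆⇒length≤ : ∀ {xs ys} → Distinct xs → (∀ {z} → z ∈ xs → z ∈ ys) → length xs ≤ length ys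
  distinct-⊆⇒length≤ {[]} _ _ = z≤n
  distinct-⊆⇒length≤ {x ∷ xs} {ys} (x∉ ∷ dxs) xs⊆ys =
    subst (suc (length xs) ≤_) (sym (length-delete ys x∈ys))
      (s≤s (distinct-⊆⇒length≤ dxs (λ zm → ∈-delete ys x∈ys (xs⊆ys (there zm)) (λ e → All.lookup x∉ zm (sym e)))))
    where
    x∈ys : x ∈ ys
    x∈ys = xs⊆ys (here refl)

  length-filter-split : ∀ {P : ℕ → Set} (P? : Decidable P) xs →
    length (filter P? xs) + length (filter (λ y → ¬? (P? y)) xs) ≡ length xs
  length-filter-split P? [] = refl
  length-filter-split P? (x ∷ xs) with P? x
  ... | yes _ = cong suc (length-filter-split P? xs)
  ... | no _  = trans (+-suc _ _) (cong suc (length-filter-split P? xs))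

  nth : List ℕ → ℕ → ℕ
  nth []       _       = 0
  nth (x ∷ xs) zero    = x
  nth (x ∷ xs) (suc j) = nth xs j

  nth∈ : ∀ xs j → j < length xs → nth xs j ∈ xs
  nth∈ (x ∷ xs) zero    _         = here refl
  nth∈ (x ∷ xs) (suc j) (s≤s j<) = there (nth∈ xs j j<)

  ∈⇒nth : ∀ {z} xs → z ∈ xs → Σ ℕ λ j → j < length xs × nth xs j ≡ z
  ∈⇒nth (x ∷ xs) (here refl) = 0 , s≤s z≤n , refl
  ∈⇒nth (x ∷ xs) (there m) with ∈⇒nth xs m
  ... | j , j< , e = suc j , s≤s j< , e

  sorted-nth : ∀ {xs} → Sorted xs → ∀ i j → i < j → j < length xs → nth xs i < nth xs j
  sorted-nth {x ∷ xs} (x< ∷ _) zero (suc j) _ (s≤s j<) = All.lookup x< (nth∈ xs j j<)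
  sorted-nth {x ∷ xs} (_ ∷ s) (suc i) (suc j) (s≤s i<j) (s≤s j<) = sorted-nth s i j i<j j<

  sorted-nth≤ : ∀ {xs} → Sorted xs → ∀ i j → i ≤ j → j < length xs → nth xs i ≤ nth xs j
  sorted-nth≤ s i j i≤j j< with m≤n⇒m<n∨m≡n i≤j
  ... | inj₁ i<j  = <⇒≤ (sorted-nth s i j i<j j<)
  ... | inj₂ refl = ≤-refl

  nth-sorted : ∀ xs → (∀ i j → i < j → j < length xs → nth xs i < nth xs j) → Sorted xs
  nth-sorted [] _ = []
  nth-sorted (x ∷ xs) inc = All.tabulate x<tail ∷ nth-sorted xs (λ i j i<j j< → inc (suc i) (suc j) (s≤s i<j) (s≤s j<))
    where
    x<tail : ∀ {z} → z ∈ xs → x < z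
    x<tail m with ∈⇒nth xs m
    ... | j , j< , refl = inc 0 (suc j) (s≤s z≤n) (s≤s j<)

  ∈take⇒nth : ∀ {z} m (xs : List ℕ) → z ∈ take m xs → Σ ℕ λ j → j < m × j < length xs × nth xs j ≡ z
  ∈take⇒nth (suc m) (x ∷ xs) (here refl) = 0 , s≤s z≤n , s≤s z≤n , refl
  ∈take⇒nth (suc m) (x ∷ xs) (there zm) with ∈take⇒nth m xs zm
  ... | j , j<m , j< , e = suc j , s≤s j<m , s≤s j< , e

  nth∈take : ∀ m (xs : List ℕ) j → j < m → j < length xs → nth xs j ∈ take m xs
  nth∈take (suc m) (x ∷ xs) zero    _         _         = here refl
  nth∈take (suc m) (x ∷ xs) (suc j) (s≤s j<m) (s≤s j<) = there (nth∈take m xs j j<m j<)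

  take⊆ : ∀ m (xs : List ℕ) {z} → z ∈ take m xs → z ∈ xs
  take⊆ (suc m) (x ∷ xs) (here refl) = here refl
  take⊆ (suc m) (x ∷ xs) (there zm)  = there (take⊆ m xs zm)

  length-take≤ : ∀ m (xs : List ℕ) → length (take m xs) ≤ m
  length-take≤ m xs = subst (_≤ m) (sym (length-take m xs)) (m⊓n≤m m (length xs))

  length-take-exact : ∀ m (xs : List ℕ) → m ≤ length xs → length (take m xs) ≡ m
  length-take-exact m xs m≤ = trans (length-take m xs) (m≤n⇒m⊓n≡m m≤)

  drop-head : ∀ t (xs : List ℕ) {i rest} → drop t xs ≡ i ∷ rest → nth xs t ≡ i × t < length xs
  drop-head zero    (x ∷ xs) refl = refl , s≤s z≤n
  drop-head (suc t) (x ∷ xs) e with drop-head t xs e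
  ... | nth≡ , t< = nth≡ , s≤s t<

  drop-tail : ∀ t (xs : List ℕ) {i rest} → drop t xs ≡ i ∷ rest → drop (suc t) xs ≡ rest
  drop-tail zero    (x ∷ xs) refl = refl
  drop-tail (suc t) (x ∷ xs) e    = drop-tail t xs e

  length-complement : ∀ N {r} → Sorted r → (∀ {x} → x ∈ r → 1 ≤ x × x ≤ N) →
    length r + length (filter (λ y → ¬? (y ∈? r)) (range N)) ≡ N
  length-complement N {r} s r⊆ =
    trans (cong (λ l → length l + length (filter (λ y → ¬? (y ∈? r)) (range N))) (sym members)) (trans (length-filter-split (_∈? r) (range N)) (length-range N))
    where
    members : filter (_∈? r) (range N) ≡ r
    members = sorted-ext (AllPairsₚ.filter⁺ (_∈? r) (range-sorted N)) s
      (λ m → proj₂ (∈-filter⁻ (_∈? r) {xs = range N} m))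
      (λ m → let (1≤x , x≤N) = r⊆ m in ∈-filter⁺ (_∈? r) (∈-range⁺ 1≤x x≤N) m)

  map-distinct : ∀ (f : ℕ → ℕ) {xs} → Distinct xs →
    (∀ {x y} → x ∈ xs → y ∈ xs → f x ≡ f y → x ≡ y) → Distinct (map f xs)
  map-distinct f [] _ = []
  map-distinct f (x∉ ∷ dxs) inj =
    Allₚ.map⁺ (All.tabulate (λ y∈ fx≡fy → All.lookup x∉ y∈ (inj (here refl) (there y∈) fx≡fy)))
    ∷ map-distinct f dxs (λ x∈ y∈ → inj (there x∈) (there y∈))

  injection⇒length≤ : ∀ (f : ℕ → ℕ) {xs ys} → Distinct xs →
    (∀ {x y} → x ∈ xs → y ∈ xs → f x ≡ f y → x ≡ y) → (∀ {x} → x ∈ xs → f x ∈ ys) →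
    length xs ≤ length ys
  injection⇒length≤ f {xs} dxs inj into =
    subst (_≤ _) (length-map f xs) (distinct-⊆⇒length≤ (map-distinct f dxs inj) image⊆)
    where
    image⊆ : ∀ {z} → z ∈ map f xs → z ∈ _
    image⊆ z∈ = let (x , x∈ , z≡fx) = ∈-map⁻ f z∈ in subst (_∈ _) (sym z≡fx) (into x∈)

module GreedyPairing where

  open Defs using (largestBelow; remove; pairingFrom)
  open SortedLists
  open import Data.Nat
  open import Data.Nat.Properties
  open import Data.List using (List; []; _∷_; length; map; filter; take; drop; _++_; [_])
  open import Data.List.Properties using (++-assoc)
  open import Data.List.Membership.Propositional using (_∈_; _∉_; find; lose)
  open import Data.List.Membership.Propositional.Properties using (∈-++⁺ˡ; ∈-++⁺ʳ; ∈-++⁻; ∈-filter⁺; ∈-filter⁻)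
  open import Data.List.Membership.DecPropositional _≟_ using (_∈?_)
  open import Data.List.Relation.Unary.All as All using (All; []; _∷_)
  open import Data.List.Relation.Unary.Any as Any using (here; there)
  open import Data.List.Relation.Unary.AllPairs as AllPairs using (AllPairs; []; _∷_)
  open import Data.List.Relation.Unary.AllPairs.Properties as AllPairsₚ using ()
  open import Data.Maybe using (Maybe; just; nothing)
  open import Data.Product using (Σ; _×_; _,_; proj₁; proj₂)
  open import Data.Sum using (_⊎_; inj₁; inj₂)
  open import Data.Empty using (⊥; ⊥-elim)
  open import Data.Unit using (⊤; tt)
  open import Relation.Nullary using (Dec; yes; no; ¬?)
  open import Relation.Nullary.Decidable using (decidable-stable)
  open import Relation.Binary.PropositionalEquality hiding ([_])

  MaxBelow : (ℕ → Set) → ℕ → ℕ → Set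
  MaxBelow A i s = A s × s < i × (∀ y → A y → y < i → y ≤ s)

  MaxBelow-resp : ∀ {A A' : ℕ → Set} {i s} → (∀ {y} → A y → A' y) → (∀ {y} → A' y → A y) →
    MaxBelow A i s → MaxBelow A' i s
  MaxBelow-resp to from (a , s<i , max) = to a , s<i , λ y a' y<i → max y (from a') y<i

  LargestBelowSpec : ℕ → List ℕ → Maybe ℕ → Set
  LargestBelowSpec i xs nothing  = ∀ y → y ∈ xs → y < i → ⊥
  LargestBelowSpec i xs (just s) = MaxBelow (_∈ xs) i s

  largestBelow-spec : ∀ i xs → LargestBelowSpec i xs (largestBelow i xs)
  largestBelow-spec i [] = λ _ ()
  largestBelow-spec i (x ∷ xs) with x <? i | largestBelow i xs | largestBelow-spec i xs
  ... | yes x<i | nothing | none = here refl , x<i , max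
    where
    max : ∀ y → y ∈ x ∷ xs → y < i → y ≤ x
    max y (here refl) _   = ≤-refl
    max y (there m)   y<i = ⊥-elim (none y m y<i)
  ... | yes x<i | just s | (s∈ , s<i , maxs) with ⊔-sel x s
  ...   | inj₁ x⊔s≡x rewrite x⊔s≡x = here refl , x<i , max
    where
    max : ∀ y → y ∈ x ∷ xs → y < i → y ≤ x
    max y (here refl) _   = ≤-refl
    max y (there m)   y<i = subst (y ≤_) x⊔s≡x (≤-trans (maxs y m y<i) (m≤n⊔m x s))
  ...   | inj₂ x⊔s≡s rewrite x⊔s≡s = there s∈ , s<i , max
    where
    max : ∀ y → y ∈ x ∷ xs → y < i → y ≤ s
    max y (here refl) _   = subst (x ≤_) x⊔s≡s (m≤m⊔n x s)
    max y (there m)   y<i = maxs y m y<i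
  largestBelow-spec i (x ∷ xs) | no x≮i | nothing | none =
    λ { y (here refl) y<i → x≮i y<i ; y (there m) y<i → none y m y<i }
  largestBelow-spec i (x ∷ xs) | no x≮i | just s | (s∈ , s<i , maxs) =
    there s∈ , s<i , λ { y (here refl) y<i → ⊥-elim (x≮i y<i) ; y (there m) y<i → maxs y m y<i }

  largestBelow-just : ∀ i xs s → MaxBelow (_∈ xs) i s → largestBelow i xs ≡ just s
  largestBelow-just i xs s (s∈ , s<i , maxs) with largestBelow i xs | largestBelow-spec i xs
  ... | nothing | none = ⊥-elim (none s s∈ s<i)
  ... | just s' | (s'∈ , s'<i , maxs') = cong just (≤-antisym (maxs s' s'∈ s'<i) (maxs' s s∈ s<i))

  ∈-remove⁻ : ∀ {y s} xs → y ∈ remove s xs → y ∈ xs × y ≢ s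
  ∈-remove⁻ {y} {s} (x ∷ xs) m with x ≟ s
  ... | yes _ = let (y∈ , y≢s) = ∈-remove⁻ xs m in there y∈ , y≢s
  ∈-remove⁻ (x ∷ xs) (here refl) | no x≢s = here refl , x≢s
  ∈-remove⁻ (x ∷ xs) (there m)   | no _   = let (y∈ , y≢s) = ∈-remove⁻ xs m in there y∈ , y≢s

  ∈-remove⁺ : ∀ {y s} xs → y ∈ xs → y ≢ s → y ∈ remove s xs
  ∈-remove⁺ {y} {s} (x ∷ xs) m y≢s with x ≟ s
  ∈-remove⁺ (x ∷ xs) (here refl) y≢s | yes x≡s = ⊥-elim (y≢s x≡s)
  ∈-remove⁺ (x ∷ xs) (there m)   y≢s | yes _   = ∈-remove⁺ xs m y≢s
  ∈-remove⁺ (x ∷ xs) (here refl) y≢s | no _    = here refl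
  ∈-remove⁺ (x ∷ xs) (there m)   y≢s | no _    = there (∈-remove⁺ xs m y≢s)

  GreedyRun : (ℕ → Set) → List ℕ → (ℕ → ℕ) → Set
  GreedyRun A []       p = ⊤
  GreedyRun A (i ∷ is) p = MaxBelow A i (p i) × GreedyRun (λ y → A y × y ≢ p i) is p

  GreedyRun-resp : ∀ {A A' : ℕ → Set} is p → (∀ {y} → A y → A' y) → (∀ {y} → A' y → A y) →
    GreedyRun A is p → GreedyRun A' is p
  GreedyRun-resp []       p to from _ = tt
  GreedyRun-resp (i ∷ is) p to from (mb , run) =
    MaxBelow-resp to from mb ,
    GreedyRun-resp is p (λ (a , ne) → to a , ne) (λ (a , ne) → from a , ne) run

  GreedyRun-cong : ∀ {A : ℕ → Set} is p q → (∀ {x} → x ∈ is → p x ≡ q x) → GreedyRun A is q → GreedyRun A is p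
  GreedyRun-cong []       p q _   _ = tt
  GreedyRun-cong (i ∷ is) p q p≗q (mb , run) rewrite p≗q (here refl) =
    mb , GreedyRun-cong is p q (λ m → p≗q (there m)) run

  pairingFrom-run : ∀ is avail (A : ℕ → Set) p → (∀ {y} → y ∈ avail → A y) → (∀ {y} → A y → y ∈ avail) →
    GreedyRun A is p → pairingFrom avail is ≡ just (map (λ i → (i , p i)) is)
  pairingFrom-run [] avail A p _ _ _ = refl
  pairingFrom-run (i ∷ is) avail A p to from (mb , run)
    with largestBelow i avail | largestBelow-just i avail (p i) (MaxBelow-resp from to mb)
  ... | .(just (p i)) | refl
    with pairingFrom (remove (p i) avail) is
       | pairingFrom-run is (remove (p i) avail) (λ y → A y × y ≢ p i) p
           (λ m → let (y∈ , y≢) = ∈-remove⁻ avail m in to y∈ , y≢)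
           (λ (a , y≢) → ∈-remove⁺ avail (from a) y≢) run
  ... | .(just _) | refl = refl

  sorted-++ʳ : ∀ pre {ys} → Sorted (pre ++ ys) → Sorted ys
  sorted-++ʳ []        s       = s
  sorted-++ʳ (x ∷ pre) (_ ∷ s) = sorted-++ʳ pre s

  before⇒< : ∀ pre {i post j} → Sorted (pre ++ i ∷ post) → j ∈ pre → j < i
  before⇒< (x ∷ pre) (x< ∷ _) (here refl) = All.lookup x< (∈-++⁺ʳ pre (here refl))
  before⇒< (x ∷ pre) (_ ∷ s)  (there m)   = before⇒< pre s m

  <⇒before : ∀ pre {i post j} → Sorted (pre ++ i ∷ post) → j ∈ pre ++ i ∷ post → j < i → j ∈ pre
  <⇒before pre s m j<i with ∈-++⁻ pre m
  ... | inj₁ m'          = m'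
  ... | inj₂ (here refl) = ⊥-elim (<-irrefl refl j<i)
  ... | inj₂ (there m') with sorted-++ʳ pre s
  ...   | i< ∷ _ = ⊥-elim (<-asym j<i (All.lookup i< m'))

  module Greedy (r1 : List ℕ) (p : ℕ → ℕ) where

    AvailableAt : List ℕ → ℕ → ℕ → Set
    AvailableAt r2 i y = y ∈ r1 × (∀ j → j ∈ r2 → j < i → p j ≢ y)

    IsGreedy : List ℕ → Set
    IsGreedy r2 = ∀ i → i ∈ r2 → MaxBelow (AvailableAt r2 i) i (p i)

    private
      Unused : List ℕ → ℕ → Set
      Unused pre y = y ∈ r1 × (∀ j → j ∈ pre → p j ≢ y)

      available⇒unused : ∀ pre {i post y} → Sorted (pre ++ i ∷ post) → AvailableAt (pre ++ i ∷ post) i y → Unused pre y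
      available⇒unused pre s (y∈ , free) = y∈ , λ j jm → free j (∈-++⁺ˡ jm) (before⇒< pre s jm)

      unused⇒available : ∀ pre {i post y} → Sorted (pre ++ i ∷ post) → Unused pre y → AvailableAt (pre ++ i ∷ post) i y
      unused⇒available pre s (y∈ , free) = y∈ , λ j jm j<i → free j (<⇒before pre s jm j<i)

      unused-snoc⁻ : ∀ pre {i y} → Unused (pre ++ [ i ]) y → Unused pre y × y ≢ p i
      unused-snoc⁻ pre {i} (y∈ , free) = (y∈ , λ j jm → free j (∈-++⁺ˡ jm)) , λ e → free i (∈-++⁺ʳ pre (here refl)) (sym e)

      unused-snoc⁺ : ∀ pre {i y} → Unused pre y × y ≢ p i → Unused (pre ++ [ i ]) y
      unused-snoc⁺ pre {i} ((y∈ , free) , y≢) = y∈ , λ j jm → step j (∈-++⁻ pre jm)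
        where
        step : ∀ j → (j ∈ pre) ⊎ (j ∈ [ i ]) → p j ≢ _
        step j (inj₁ m)         = free j m
        step j (inj₂ (here refl)) = λ e → y≢ (sym e)

      reassoc : ∀ pre i post → Sorted (pre ++ i ∷ post) → Sorted ((pre ++ [ i ]) ++ post)
      reassoc pre i post = subst Sorted (sym (++-assoc pre [ i ] post))

      greedy⇒run : ∀ pre post → Sorted (pre ++ post) →
        (∀ i → i ∈ post → MaxBelow (AvailableAt (pre ++ post) i) i (p i)) → GreedyRun (Unused pre) post p
      greedy⇒run pre []         _ _ = tt
      greedy⇒run pre (i ∷ post) s g =
        MaxBelow-resp (available⇒unused pre s) (unused⇒available pre s) (g i (here refl)) ,
        GreedyRun-resp post p (unused-snoc⁻ pre) (unused-snoc⁺ pre)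
          (greedy⇒run (pre ++ [ i ]) post (reassoc pre i post s)
            (λ i' m → subst (λ L → MaxBelow (AvailableAt L i') i' (p i')) (sym (++-assoc pre [ i ] post)) (g i' (there m))))

      run⇒greedy : ∀ pre post → Sorted (pre ++ post) → GreedyRun (Unused pre) post p →
        ∀ i → i ∈ post → MaxBelow (AvailableAt (pre ++ post) i) i (p i)
      run⇒greedy pre (i ∷ post) s (mb , _) .i (here refl) =
        MaxBelow-resp (unused⇒available pre s) (available⇒unused pre s) mb
      run⇒greedy pre (i ∷ post) s (_ , run) i' (there m) =
        subst (λ L → MaxBelow (AvailableAt L i') i' (p i')) (++-assoc pre [ i ] post)
          (run⇒greedy (pre ++ [ i ]) post (reassoc pre i post s)
            (GreedyRun-resp post p (unused-snoc⁺ pre) (unused-snoc⁻ pre) run) i' m)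

    run-from-r1⇒greedy : ∀ r2 → Sorted r2 → GreedyRun (_∈ r1) r2 p → IsGreedy r2
    run-from-r1⇒greedy r2 s run =
      run⇒greedy [] r2 s (GreedyRun-resp r2 p (λ y∈ → y∈ , λ _ ()) proj₁ run)

    greedy⇒pairing : ∀ r2 → Sorted r2 → IsGreedy r2 → pairingFrom r1 r2 ≡ just (map (λ i → (i , p i)) r2)
    greedy⇒pairing r2 s g =
      pairingFrom-run r2 r1 (_∈ r1) p (λ m → m) (λ m → m)
        (GreedyRun-resp r2 p proj₁ (λ y∈ → y∈ , λ _ ()) (greedy⇒run [] r2 s g))

  module GreedyExists (r1 r2 : List ℕ) (n : ℕ) (s1 : Sorted r1) (s2 : Sorted r2)
                      (len1 : length r1 ≡ n) (len2 : length r2 ≡ n)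
                      (ballot : ∀ j → j < n → nth r1 j < nth r2 j) where

    Free : List ℕ → ℕ → Set
    Free us y = y ∈ r1 × y ∉ us

    free? : (us : List ℕ) → (y : ℕ) → Dec (y ∉ us)
    free? us y = ¬? (y ∈? us)

    freeList : List ℕ → List ℕ
    freeList us = filter (free? us) r1

    prefix-below : ∀ {t y} → t < n → y ∈ take (suc t) r1 → y < nth r2 t
    prefix-below {t} t<n y∈ with ∈take⇒nth (suc t) r1 y∈
    ... | j , s≤s j≤t , _ , refl =
      ≤-<-trans (sorted-nth≤ s1 j t j≤t (subst (t <_) (sym len1) t<n)) (ballot t t<n)

    -- When the t-th entry of row 2 is processed, only t values are used, so
    -- one of the t+1 candidates below it is still free.
    free-below : ∀ t us → t < n → Distinct us → length us ≡ t → Σ ℕ λ y → Free us y × y < nth r2 t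
    free-below t us t<n dus |us| with Any.any? (free? us) (take (suc t) r1)
    ... | yes some = let (y , y∈ , y∉) = find some in y , (take⊆ (suc t) r1 y∈ , y∉) , prefix-below t<n y∈
    ... | no none = ⊥-elim (<-irrefl (sym |us|) (subst (_≤ length us) (length-take-exact (suc t) r1 (subst (t <_) (sym len1) t<n))
            (distinct-⊆⇒length≤ (AllPairsₚ.take⁺ (suc t) (sorted⇒distinct s1)) used)))
      where
      used : ∀ {y} → y ∈ take (suc t) r1 → y ∈ us
      used y∈ = decidable-stable (_ ∈? us) (λ y∉ → none (lose y∈ y∉))

    private
      extend : ℕ → ℕ → (ℕ → ℕ) → ℕ → ℕ
      extend i s p x with x ≟ i
      ... | yes _ = s
      ... | no _  = p x

      extend-here : ∀ i s p → extend i s p i ≡ s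
      extend-here i s p with i ≟ i
      ... | yes _  = refl
      ... | no i≢i = ⊥-elim (i≢i refl)

      extend-elsewhere : ∀ i s p x → x ≢ i → extend i s p x ≡ p x
      extend-elsewhere i s p x x≢i with x ≟ i
      ... | yes x≡i = ⊥-elim (x≢i x≡i)
      ... | no _    = refl

    run-from : ∀ t post us → drop t r2 ≡ post → Distinct us → length us ≡ t →
      Σ (ℕ → ℕ) λ p → GreedyRun (Free us) post p
    run-from t [] us _ _ _ = (λ _ → 0) , tt
    run-from t (i ∷ post) us suffix dus |us|
      with drop-head t r2 suffix | largestBelow i (freeList us) | largestBelow-spec i (freeList us)
    ... | r2[t]≡i , t<len | nothing | none =
      let (y , (y∈ , y∉) , y<) = free-below t us (subst (t <_) len2 t<len) dus |us|
      in ⊥-elim (none y (∈-filter⁺ (free? us) y∈ y∉) (subst (y <_) r2[t]≡i y<))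
    ... | _ | just s | max-s
      with run-from (suc t) post (s ∷ us) (drop-tail t r2 suffix)
             (All.tabulate (λ u∈ s≡u → proj₂ free-s (subst (_∈ us) (sym s≡u) u∈)) ∷ dus) (cong suc |us|)
      where
      free-s : Free us s
      free-s = ∈-filter⁻ (free? us) {xs = r1} (proj₁ max-s)
    ...   | p , run = extend i s p , first , rest
      where
      max-free : MaxBelow (Free us) i s
      max-free = MaxBelow-resp (∈-filter⁻ (free? us) {xs = r1}) (λ (y∈ , y∉) → ∈-filter⁺ (free? us) y∈ y∉) max-s
      first : MaxBelow (Free us) i (extend i s p i)
      first = subst (MaxBelow (Free us) i) (sym (extend-here i s p)) max-free
      i<post : All (i <_) post
      i<post = AllPairs.head (subst Sorted suffix (AllPairsₚ.drop⁺ t s2))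
      rest : GreedyRun (λ y → Free us y × y ≢ extend i s p i) post (extend i s p)
      rest = GreedyRun-cong post (extend i s p) p
               (λ {x} x∈ → extend-elsewhere i s p x (λ x≡i → <-irrefl (sym x≡i) (All.lookup i<post x∈)))
               (GreedyRun-resp post p
                  (λ (y∈ , y∉) → (y∈ , λ y∈us → y∉ (there y∈us)) , λ y≡ → y∉ (here (trans y≡ (extend-here i s p))))
                  (λ ((y∈ , y∉) , y≢) → y∈ , λ { (here y≡s) → y≢ (trans y≡s (sym (extend-here i s p))) ; (there y∈us) → y∉ y∈us })
                  run)

    greedy-run : Σ (ℕ → ℕ) λ p → GreedyRun (_∈ r1) r2 p
    greedy-run with run-from 0 r2 [] refl [] refl
    ... | p , run = p , GreedyRun-resp r2 p proj₁ (λ y∈ → y∈ , λ ()) run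

module Forests where

  open Defs using (Conn; c-refl; c-edge; c-sym; c-trans)
  open import Data.Nat
  open import Data.Nat.Properties
  open import Data.List using (List; map)
  open import Data.List.Membership.Propositional using (_∈_; _∉_)
  open import Data.List.Membership.Propositional.Properties using (∈-map⁺; ∈-map⁻)
  open import Data.List.Membership.DecPropositional _≟_ using (_∈?_)
  open import Data.Product using (Σ; _×_; _,_)
  open import Data.Empty using (⊥-elim)
  open import Relation.Nullary using (yes; no)
  open import Relation.Binary using (tri<; tri≈; tri>)
  open import Relation.Binary.PropositionalEquality

  -- A forest on ℕ: every x ∈ r2 has the parent p x < x; the elements outside
  -- r2 are roots.  The edges (i , p i) generate the equivalence "same tree".
  module ParentForest (r2 : List ℕ) (p : ℕ → ℕ) (p< : ∀ {x} → x ∈ r2 → p x < x) where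

    edges : List (ℕ × ℕ)
    edges = map (λ i → (i , p i)) r2

    edge : ∀ {i} → i ∈ r2 → (i , p i) ∈ edges
    edge = ∈-map⁺ (λ i → (i , p i))

    edge⁻ : ∀ {x y} → (x , y) ∈ edges → x ∈ r2 × y ≡ p x
    edge⁻ m with ∈-map⁻ (λ i → (i , p i)) m
    ... | _ , i∈ , refl = i∈ , refl

    0∉r2 : 0 ∉ r2
    0∉r2 m = n≮0 (p< m)

    -- Follow parents for at most `fuel` steps; fuel x suffices since p decreases.
    ascend : ℕ → ℕ → ℕ
    ascend zero       x = x
    ascend (suc fuel) x with x ∈? r2
    ... | yes _ = ascend fuel (p x)
    ... | no _  = x

    root : ℕ → ℕ
    root x = ascend x x

    ascend-enough : ∀ f g x → x ≤ f → x ≤ g → ascend f x ≡ ascend g x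
    ascend-enough zero zero x _ _ = refl
    ascend-enough zero (suc g) .0 z≤n _ with 0 ∈? r2
    ... | yes m = ⊥-elim (0∉r2 m)
    ... | no _  = refl
    ascend-enough (suc f) zero .0 _ z≤n with 0 ∈? r2
    ... | yes m = ⊥-elim (0∉r2 m)
    ... | no _  = refl
    ascend-enough (suc f) (suc g) x x≤f x≤g with x ∈? r2
    ... | yes m = ascend-enough f g (p x) (s≤s⁻¹ (≤-trans (p< m) x≤f)) (s≤s⁻¹ (≤-trans (p< m) x≤g))
    ... | no _  = refl

    root-parent : ∀ {x} → x ∈ r2 → root x ≡ root (p x)
    root-parent {zero} m = ⊥-elim (0∉r2 m)
    root-parent {suc x} m with suc x ∈? r2
    ... | yes _  = ascend-enough x (p (suc x)) (p (suc x)) (s≤s⁻¹ (p< m)) ≤-refl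
    ... | no x∉  = ⊥-elim (x∉ m)

    root-of-root : ∀ {x} → x ∉ r2 → root x ≡ x
    root-of-root {zero} _ = refl
    root-of-root {suc x} x∉ with suc x ∈? r2
    ... | yes m = ⊥-elim (x∉ m)
    ... | no _  = refl

    ascend-≤ : ∀ f x → ascend f x ≤ x
    ascend-≤ zero x = ≤-refl
    ascend-≤ (suc f) x with x ∈? r2
    ... | yes m = ≤-trans (ascend-≤ f (p x)) (<⇒≤ (p< m))
    ... | no _  = ≤-refl

    root-≤ : ∀ x → root x ≤ x
    root-≤ x = ascend-≤ x x

    ascend-∉ : ∀ f x → x ≤ f → ascend f x ∉ r2
    ascend-∉ zero .0 z≤n = 0∉r2
    ascend-∉ (suc f) x x≤f with x ∈? r2
    ... | yes m = ascend-∉ f (p x) (s≤s⁻¹ (≤-trans (p< m) x≤f))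
    ... | no x∉ = x∉

    root-∉ : ∀ x → root x ∉ r2
    root-∉ x = ascend-∉ x x ≤-refl

    root-idem : ∀ x → root (root x) ≡ root x
    root-idem x = root-of-root (root-∉ x)

    ascend-reach : (Q : ℕ → Set) → (∀ {y} → y ∈ r2 → Q y → Q (p y)) → ∀ f {x} → Q x → Q (ascend f x)
    ascend-reach Q step zero    q = q
    ascend-reach Q step (suc f) {x} q with x ∈? r2
    ... | yes x∈ = ascend-reach Q step f (step x∈ q)
    ... | no _   = q

    root-reach : (Q : ℕ → Set) → (∀ {y} → y ∈ r2 → Q y → Q (p y)) → ∀ {x} → Q x → Q (root x)
    root-reach Q step {x} = ascend-reach Q step x

    conn-root : ∀ x → Conn edges x (root x)
    conn-root x = root-reach (Conn edges x) (λ y∈ c → c-trans c (c-edge (edge y∈))) c-refl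

    conn⇒same-root : ∀ {x y} → Conn edges x y → root x ≡ root y
    conn⇒same-root c-refl = refl
    conn⇒same-root (c-edge m) with edge⁻ m
    ... | x∈ , refl = root-parent x∈
    conn⇒same-root (c-sym c)     = sym (conn⇒same-root c)
    conn⇒same-root (c-trans c d) = trans (conn⇒same-root c) (conn⇒same-root d)

    same-root⇒conn : ∀ {x y} → root x ≡ root y → Conn edges x y
    same-root⇒conn {x} {y} e =
      c-trans (conn-root x) (subst (λ z → Conn edges z y) (sym e) (c-sym (conn-root y)))

    data OnChain (a : ℕ) : ℕ → Set where
      start : OnChain a a
      above : ∀ {c} → c ∈ r2 → OnChain a (p c) → OnChain a c

    chain-≤ : ∀ {a c} → OnChain a c → a ≤ c
    chain-≤ start        = ≤-refl
    chain-≤ (above m ch) = ≤-trans (chain-≤ ch) (<⇒≤ (p< m))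

    chain-parent : ∀ {a c} → OnChain a c → a < c → c ∈ r2 × OnChain a (p c)
    chain-parent start         a<c = ⊥-elim (<-irrefl refl a<c)
    chain-parent (above m ch) _   = m , ch

    chain-child : ∀ {a c} → OnChain a c → a < c → Σ ℕ λ z → z ∈ r2 × p z ≡ a × z ≤ c
    chain-child start a<c = ⊥-elim (<-irrefl refl a<c)
    chain-child {a} (above {c} m ch) _ with a ≟ p c
    ... | yes a≡ = c , m , sym a≡ , ≤-refl
    ... | no a≢ with chain-child ch (≤∧≢⇒< (chain-≤ ch) a≢)
    ...   | z , z∈ , pz≡a , z≤ = z , z∈ , pz≡a , ≤-trans z≤ (<⇒≤ (p< m))

    module Injective (p-inj : ∀ {x y} → x ∈ r2 → y ∈ r2 → p x ≡ p y → x ≡ y) where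

      private
        chain-fuel : ∀ fuel x y → x + y < fuel → root x ≡ root y → x ≤ y → OnChain x y
        chain-fuel (suc fuel) x y x+y< same x≤y with x ≟ y
        ... | yes refl = start
        ... | no x≢y with y ∈? r2
        ...   | no y∉ = ⊥-elim (<-irrefl refl (≤-<-trans (subst (_≤ x) (trans same (root-of-root y∉)) (root-≤ x)) (≤∧≢⇒< x≤y x≢y)))
        ...   | yes y∈ with x ≤? p y
        ...     | yes x≤py = above y∈ (chain-fuel fuel x (p y) smaller (trans same (root-parent y∈)) x≤py)
          where
          smaller : x + p y < fuel
          smaller = <-≤-trans (+-monoʳ-< x (p< y∈)) (s≤s⁻¹ x+y<)
        ...     | no x≰py with chain-child (chain-fuel fuel (p y) x smaller (sym (trans same (root-parent y∈))) (<⇒≤ (≰⇒> x≰py))) (≰⇒> x≰py)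
          where
          smaller : p y + x < fuel
          smaller = <-≤-trans (subst (_< x + y) (+-comm x (p y)) (+-monoʳ-< x (p< y∈))) (s≤s⁻¹ x+y<)
        ...       | z , z∈ , pz≡py , z≤x with p-inj z∈ y∈ pz≡py
        ...         | refl = ⊥-elim (<-irrefl refl (≤-<-trans z≤x (≤∧≢⇒< x≤y x≢y)))

      chain : ∀ {x y} → root x ≡ root y → x ≤ y → OnChain x y
      chain {x} {y} = chain-fuel (suc (x + y)) x y ≤-refl

      straddle : ∀ {a b c} → OnChain a c → a < b → b < c → root b ≢ root c →
        Σ ℕ λ u → u ∈ r2 × p u < b × b < u × root u ≡ root c × u ≤ c
      straddle start a<b b<c _ = ⊥-elim (<-asym a<b b<c)
      straddle {a} {b} (above {c} m ch) a<b b<c b≁c with <-cmp (p c) b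
      ... | tri< pc<b _ _ = c , m , pc<b , b<c , refl , ≤-refl
      ... | tri≈ _ pc≡b _ = ⊥-elim (b≁c (trans (cong root (sym pc≡b)) (sym (root-parent m))))
      ... | tri> _ _ b<pc with straddle ch a<b b<pc (λ e → b≁c (trans e (sym (root-parent m))))
      ...   | u , u∈ , pu<b , b<u , same , u≤ = u , u∈ , pu<b , b<u , trans same (sym (root-parent m)) , ≤-trans u≤ (<⇒≤ (p< m))

module Partitions where

  open SortedLists
  open import Data.Nat
  open import Data.Nat.Properties
  open import Data.List using (List; []; _∷_; length; lookup; filter; map)
  open import Data.List.Properties using (length-map)
  open import Data.List.Membership.Propositional using (_∈_; find; lose)
  open import Data.List.Membership.Propositional.Properties using (∈-filter⁺; ∈-filter⁻)
  open import Data.List.Relation.Unary.All as All using (All; []; _∷_)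
  open import Data.List.Relation.Unary.All.Properties as Allₚ using ()
  open import Data.List.Relation.Unary.Any as Any using (Any; here; there)
  open import Data.List.Relation.Unary.Any.Properties as Anyₚ using (lookup-index)
  open import Data.List.Relation.Unary.AllPairs as AllPairs using (AllPairs; []; _∷_)
  open import Data.List.Relation.Unary.AllPairs.Properties as AllPairsₚ using ()
  open import Data.List.Relation.Unary.Linked using (Linked; []; [-]; _∷_)
  open import Data.List.Relation.Unary.Linked.Properties using (Linked⇒AllPairs; AllPairs⇒Linked)
  open import Data.Fin using (Fin; zero; suc)
  open import Data.Fin.Properties using () renaming (suc-injective to fsuc-injective)
  import Data.Fin as Fin
  open import Data.Product using (Σ; _×_; _,_; proj₁; proj₂)
  open import Data.Empty using (⊥; ⊥-elim)
  open import Data.Unit using (tt)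
  open import Relation.Nullary using (¬_; Dec; yes; no)
  open import Relation.Binary.PropositionalEquality

  block-index : ∀ {Q : List ℕ → Set} {P : SetPartition} → Any Q P → Σ (Fin (length P)) λ i → Q (lookup P i)
  block-index a = Any.index a , lookup-index a

  at-index : ∀ {Q : List ℕ → Set} {P : SetPartition} (i : Fin (length P)) → Q (lookup P i) → Any Q P
  at-index {P = B ∷ P} zero    q = here q
  at-index {P = B ∷ P} (suc i) q = there (at-index i q)

  Disjoint : List ℕ → List ℕ → Set
  Disjoint B C = ∀ {x} → x ∈ B → x ∈ C → ⊥

  IndexDisjoint : SetPartition → Set
  IndexDisjoint P = (i j : Fin (length P)) (x : ℕ) → x ∈ lookup P i → x ∈ lookup P j → i ≡ j

  pairwise⇒index-disjoint : ∀ {P} → AllPairs Disjoint P → IndexDisjoint P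
  pairwise⇒index-disjoint (_ ∷ _)  zero    zero    x _ _ = refl
  pairwise⇒index-disjoint (dB ∷ _) zero    (suc j) x a b = ⊥-elim (All.lookup dB (at-index j refl) a b)
  pairwise⇒index-disjoint (dB ∷ _) (suc i) zero    x a b = ⊥-elim (All.lookup dB (at-index i refl) b a)
  pairwise⇒index-disjoint (_ ∷ dP) (suc i) (suc j) x a b = cong suc (pairwise⇒index-disjoint dP i j x a b)

  index⇒pairwise-disjoint : ∀ {P} → IndexDisjoint P → AllPairs Disjoint P
  index⇒pairwise-disjoint {[]} _ = []
  index⇒pairwise-disjoint {B ∷ P} disj =
    All.tabulate from-first ∷ index⇒pairwise-disjoint (λ i j x a b → fsuc-injective (disj (suc i) (suc j) x a b))
    where
    from-first : ∀ {C} → C ∈ P → Disjoint B C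
    from-first C∈ {x} a b with block-index C∈
    ... | i , refl with disj zero (suc i) x a b
    ... | ()

  blocks-disjoint : ∀ {N P} → IsSetPartition N P → IndexDisjoint P
  blocks-disjoint sp = proj₁ (proj₂ (proj₂ (proj₂ sp)))

  blocks-cover : ∀ {N P} → IsSetPartition N P → (x : ℕ) → 1 ≤ x × x ≤ N → Any (x ∈_) P
  blocks-cover sp = proj₁ (proj₂ (proj₂ (proj₂ (proj₂ sp))))

  blocks-inside : ∀ {N P} → IsSetPartition N P → (x : ℕ) → Any (x ∈_) P → 1 ≤ x × x ≤ N
  blocks-inside sp = proj₂ (proj₂ (proj₂ (proj₂ (proj₂ sp))))

  module SameBlockEquivalence {N P} (sp : IsSetPartition N P) where

    same-refl : ∀ {x} → 1 ≤ x → x ≤ N → SameBlock P x x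
    same-refl 1≤x x≤N = Any.map (λ m → m , m) (blocks-cover sp _ (1≤x , x≤N))

    same-sym : ∀ {x y} → SameBlock P x y → SameBlock P y x
    same-sym = Any.map (λ (a , b) → b , a)

    same-trans : ∀ {x y z} → SameBlock P x y → SameBlock P y z → SameBlock P x z
    same-trans s t with block-index s | block-index t
    ... | i , x∈ , y∈ | j , y∈' , z∈ with blocks-disjoint sp i j _ y∈ y∈'
    ... | refl = at-index i (x∈ , z∈)

    inside-left : ∀ {x y} → SameBlock P x y → 1 ≤ x × x ≤ N
    inside-left s = blocks-inside sp _ (Any.map proj₁ s)

    inside-right : ∀ {x y} → SameBlock P x y → 1 ≤ y × y ≤ N
    inside-right s = blocks-inside sp _ (Any.map proj₂ s)

  NoncrossingRel : SetPartition → Set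
  NoncrossingRel P = ∀ a b c d → a < b → b < c → c < d →
    SameBlock P a c → SameBlock P b d → ¬ SameBlock P a b → ⊥

  noncrossingRel⇒noncrossing : ∀ P → IndexDisjoint P → NoncrossingRel P → Noncrossing P
  noncrossingRel⇒noncrossing P disj nc i j i≢j a b c d a<b b<c c<d a∈ c∈ b∈ d∈ =
    nc a b c d a<b b<c c<d (at-index i (a∈ , c∈)) (at-index j (b∈ , d∈)) a≁b
    where
    a≁b : ¬ SameBlock P a b
    a≁b s with block-index s
    ... | l , a∈' , b∈' = i≢j (trans (disj i l a a∈ a∈') (sym (disj j l b b∈ b∈')))

  noncrossing⇒noncrossingRel : ∀ P → Noncrossing P → NoncrossingRel P
  noncrossing⇒noncrossingRel P nc a b c d a<b b<c c<d ac bd a≁b with block-index ac | block-index bd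
  ... | i , a∈ , c∈ | j , b∈ , d∈ with i Fin.≟ j
  ...   | yes refl = a≁b (at-index i (a∈ , b∈))
  ...   | no i≢j   = nc i j i≢j a b c d a<b b<c c<d a∈ c∈ b∈ d∈

  two-members : ∀ {x y : ℕ} {xs} → x ∈ xs → y ∈ xs → x ≢ y → 2 ≤ length xs
  two-members {xs = _ ∷ []}    (here refl) (here refl) x≢y = ⊥-elim (x≢y refl)
  two-members {xs = _ ∷ _ ∷ _} _ _ _ = s≤s (s≤s z≤n)

  another-member : ∀ {x xs} → Distinct xs → 2 ≤ length xs → x ∈ xs → Σ ℕ λ y → y ∈ xs × y ≢ x
  another-member {xs = _ ∷ []} _ (s≤s ()) _
  another-member {x} {a ∷ b ∷ _} (a∉ ∷ _) _ _ with a ≟ x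
  ... | yes refl = b , there (here refl) , λ b≡a → All.lookup a∉ (here refl) (sym b≡a)
  ... | no a≢x   = a , here refl , a≢x

  head∈ : ∀ {B : List ℕ} → NonEmpty B → head0 B ∈ B
  head∈ {_ ∷ _} _ = here refl

  member⇒head∈ : ∀ {x : ℕ} {B} → x ∈ B → head0 B ∈ B
  member⇒head∈ {B = _ ∷ _} _ = here refl

  head≤ : ∀ {B x} → Sorted B → x ∈ B → head0 B ≤ x
  head≤ {_ ∷ _} _        (here refl) = ≤-refl
  head≤ {_ ∷ _} (b< ∷ _) (there m)   = <⇒≤ (All.lookup b< m)

  least-is-head : ∀ {r xs} → Sorted xs → r ∈ xs → (∀ {y} → y ∈ xs → r ≤ y) → head0 xs ≡ r
  least-is-head {xs = _ ∷ _} _        (here refl) _     = refl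
  least-is-head {xs = _ ∷ _} (x< ∷ _) (there m)   least = ⊥-elim (<-irrefl refl (<-≤-trans (All.lookup x< m) (least (here refl))))

  -- A set partition is determined by its ground set and its blocks relation:
  -- blocks are sorted, ordered by their minima, and pairwise disjoint.
  Canonical : SetPartition → Set
  Canonical P = All NonEmpty P × All Sorted P × AllPairs (λ B C → head0 B < head0 C) P × AllPairs Disjoint P

  set-partition⇒canonical : ∀ {N P} → IsSetPartition N P → Canonical P
  set-partition⇒canonical (ne , sorted , heads , disj , _ , _) =
    ne , All.map (Linked⇒AllPairs <-trans) sorted , Linked⇒AllPairs <-trans heads , index⇒pairwise-disjoint disj

  InPartition : SetPartition → ℕ → Set
  InPartition P x = Any (x ∈_) P

  private
    first-block-min : ∀ {B P x} → Canonical (B ∷ P) → InPartition (B ∷ P) x → head0 B ≤ x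
    first-block-min (_ , sB ∷ _ , _ , _) (here x∈) = head≤ sB x∈
    first-block-min (_ , _ ∷ sP , B< ∷ _ , _) (there a) with find a
    ... | D , D∈ , x∈ = <⇒≤ (<-≤-trans (All.lookup B< D∈) (head≤ (All.lookup sP D∈) x∈))

    not-in-rest : ∀ {B P x} → All (Disjoint B) P → x ∈ B → InPartition P x → ⊥
    not-in-rest dB x∈B a with find a
    ... | D , D∈ , x∈D = All.lookup dB D∈ x∈B x∈D

    first-block-⊆ : ∀ {B C P Q} → Canonical (B ∷ P) → Canonical (C ∷ Q) → head0 B ≡ head0 C →
      (∀ {x y} → InPartition (B ∷ P) x → InPartition (B ∷ P) y → SameBlock (B ∷ P) x y → SameBlock (C ∷ Q) x y) →
      ∀ {x} → x ∈ B → x ∈ C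
    first-block-⊆ {B} {C} (neB ∷ _ , _) (neC ∷ _ , _ , _ , dC ∷ _) B₀≡C₀ same x∈
      with same (here (head∈ neB)) (here x∈) (here (head∈ neB , x∈))
    ... | here (_ , x∈C) = x∈C
    ... | there s with find s
    ...   | D , D∈ , B₀∈D , _ = ⊥-elim (All.lookup dC D∈ (subst (_∈ C) (sym B₀≡C₀) (head∈ neC)) B₀∈D)

    rest-member : ∀ {B C P Q x} → All (Disjoint B) P → (∀ {y} → y ∈ C → y ∈ B) →
      InPartition P x → InPartition (C ∷ Q) x → InPartition Q x
    rest-member dB C⊆B a (here x∈C) = ⊥-elim (not-in-rest dB (C⊆B x∈C) a)
    rest-member _  _   _ (there a') = a'

    rest-same : ∀ {B C P Q x y} → All (Disjoint B) P → (∀ {y} → y ∈ C → y ∈ B) →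
      InPartition P x → SameBlock (C ∷ Q) x y → SameBlock Q x y
    rest-same dB C⊆B a (here (x∈C , _)) = ⊥-elim (not-in-rest dB (C⊆B x∈C) a)
    rest-same _  _   _ (there s')       = s'

  canonical-unique : ∀ P Q → Canonical P → Canonical Q →
    (∀ {x} → InPartition P x → InPartition Q x) → (∀ {x} → InPartition Q x → InPartition P x) →
    (∀ {x y} → InPartition P x → InPartition P y → SameBlock P x y → SameBlock Q x y) →
    (∀ {x y} → InPartition Q x → InPartition Q y → SameBlock Q x y → SameBlock P x y) → P ≡ Q
  canonical-unique [] [] _ _ _ _ _ _ = refl
  canonical-unique [] (C ∷ Q) _ (neC ∷ _ , _) _ Q⊆P _ _ with Q⊆P (here (head∈ neC))
  ... | ()
  canonical-unique (B ∷ P) [] (neB ∷ _ , _) _ P⊆Q _ _ _ with P⊆Q (here (head∈ neB))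
  ... | ()
  canonical-unique (B ∷ P) (C ∷ Q) cP@(neB ∷ neP , sB ∷ sP , hB ∷ hP , dB ∷ dP) cQ@(neC ∷ neQ , sC ∷ sQ , hC ∷ hQ , dC ∷ dQ)
                   P⊆Q Q⊆P P⇒Q Q⇒P =
    cong₂ _∷_ (sorted-ext sB sC B⊆C C⊆B)
      (canonical-unique P Q (neP , sP , hP , dP) (neQ , sQ , hQ , dQ)
        (λ a → rest-member dB C⊆B a (P⊆Q (there a)))
        (λ a → rest-member dC B⊆C a (Q⊆P (there a)))
        (λ a b s → rest-same dB C⊆B a (P⇒Q (there a) (there b) (there s)))
        (λ a b s → rest-same dC B⊆C a (Q⇒P (there a) (there b) (there s))))
    where
    B₀≡C₀ : head0 B ≡ head0 C
    B₀≡C₀ = ≤-antisym (first-block-min cP (Q⊆P (here (head∈ neC)))) (first-block-min cQ (P⊆Q (here (head∈ neB))))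
    B⊆C : ∀ {x} → x ∈ B → x ∈ C
    B⊆C = first-block-⊆ cP cQ B₀≡C₀ P⇒Q
    C⊆B : ∀ {x} → x ∈ C → x ∈ B
    C⊆B = first-block-⊆ cQ cP (sym B₀≡C₀) Q⇒P

  set-partition-unique : ∀ {N P Q} → IsSetPartition N P → IsSetPartition N Q →
    (∀ x y → 1 ≤ x → x ≤ N → 1 ≤ y → y ≤ N → SameBlock P x y → SameBlock Q x y) →
    (∀ x y → 1 ≤ x → x ≤ N → 1 ≤ y → y ≤ N → SameBlock Q x y → SameBlock P x y) → P ≡ Q
  set-partition-unique {N} {P} {Q} spP spQ P⇒Q Q⇒P =
    canonical-unique P Q (set-partition⇒canonical spP) (set-partition⇒canonical spQ)
      (λ a → blocks-cover spQ _ (blocks-inside spP _ a)) (λ a → blocks-cover spP _ (blocks-inside spQ _ a))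
      (λ a b → let (1≤x , x≤N) = blocks-inside spP _ a ; (1≤y , y≤N) = blocks-inside spP _ b in P⇒Q _ _ 1≤x x≤N 1≤y y≤N)
      (λ a b → let (1≤x , x≤N) = blocks-inside spQ _ a ; (1≤y , y≤N) = blocks-inside spQ _ b in Q⇒P _ _ 1≤x x≤N 1≤y y≤N)

  module ClassPartition (N : ℕ) (ρ : ℕ → ℕ)
                        (ρ-range : ∀ {x} → 1 ≤ x → x ≤ N → 1 ≤ ρ x × ρ x ≤ x)
                        (ρ-idem : ∀ {x} → 1 ≤ x → x ≤ N → ρ (ρ x) ≡ ρ x) where

    isRep? : (x : ℕ) → Dec (ρ x ≡ x)
    isRep? x = ρ x ≟ x

    reps : List ℕ
    reps = filter isRep? (range N)

    class : ℕ → List ℕ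
    class r = filter (λ y → ρ y ≟ r) (range N)

    classes : SetPartition
    classes = map class reps

    reps-sorted : Sorted reps
    reps-sorted = AllPairsₚ.filter⁺ isRep? (range-sorted N)

    class-sorted : ∀ r → Sorted (class r)
    class-sorted r = AllPairsₚ.filter⁺ (λ y → ρ y ≟ r) (range-sorted N)

    ∈-class⁻ : ∀ {y r} → y ∈ class r → (1 ≤ y × y ≤ N) × ρ y ≡ r
    ∈-class⁻ {y} {r} m = let (y∈ , ρy≡r) = ∈-filter⁻ (λ y → ρ y ≟ r) {xs = range N} m in ∈-range⁻ y∈ , ρy≡r

    ∈-class⁺ : ∀ {y r} → 1 ≤ y → y ≤ N → ρ y ≡ r → y ∈ class r
    ∈-class⁺ {y} {r} 1≤y y≤N ρy≡r = ∈-filter⁺ (λ y → ρ y ≟ r) (∈-range⁺ 1≤y y≤N) ρy≡r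

    ∈-reps⁻ : ∀ {r} → r ∈ reps → (1 ≤ r × r ≤ N) × ρ r ≡ r
    ∈-reps⁻ m = let (r∈ , ρr≡r) = ∈-filter⁻ isRep? {xs = range N} m in ∈-range⁻ r∈ , ρr≡r

    ∈-reps⁺ : ∀ {r} → 1 ≤ r → r ≤ N → ρ r ≡ r → r ∈ reps
    ∈-reps⁺ 1≤r r≤N ρr≡r = ∈-filter⁺ isRep? (∈-range⁺ 1≤r r≤N) ρr≡r

    rep∈class : ∀ {r} → r ∈ reps → r ∈ class r
    rep∈class m = let ((1≤r , r≤N) , ρr≡r) = ∈-reps⁻ m in ∈-class⁺ 1≤r r≤N ρr≡r

    first-class : ∀ {r} → r ∈ reps → head0 (class r) ≡ r
    first-class {r} m = least-is-head (class-sorted r) (rep∈class m) r≤class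
      where
      r≤class : ∀ {y} → y ∈ class r → r ≤ y
      r≤class y∈ = let ((1≤y , y≤N) , ρy≡r) = ∈-class⁻ y∈ in subst (_≤ _) ρy≡r (proj₂ (ρ-range 1≤y y≤N))

    rep-of : ∀ {x} → 1 ≤ x → x ≤ N → ρ x ∈ reps
    rep-of 1≤x x≤N = let (1≤ρx , ρx≤x) = ρ-range 1≤x x≤N in ∈-reps⁺ 1≤ρx (≤-trans ρx≤x x≤N) (ρ-idem 1≤x x≤N)

    private
      firsts-linked : ∀ rs → Sorted rs → (∀ {r} → r ∈ rs → r ∈ reps) →
        Linked (λ B C → head0 B < head0 C) (map class rs)
      firsts-linked []            _ _ = []
      firsts-linked (r ∷ [])      _ _ = [-]
      firsts-linked (r ∷ r' ∷ rs) (r< ∷ s) ⊆reps =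
        subst₂ _<_ (sym (first-class (⊆reps (here refl)))) (sym (first-class (⊆reps (there (here refl)))))
          (All.lookup r< (here refl))
        ∷ firsts-linked (r' ∷ rs) s (λ m → ⊆reps (there m))

      classes-disjoint : AllPairs Disjoint classes
      classes-disjoint = AllPairsₚ.map⁺ (AllPairs.map
        (λ r<r' {_} a b → <-irrefl (trans (sym (proj₂ (∈-class⁻ a))) (proj₂ (∈-class⁻ b))) r<r') reps-sorted)

    classes-partition : IsSetPartition N classes
    classes-partition =
      Allₚ.map⁺ (All.tabulate (λ m → nonEmpty (rep∈class m))) ,
      Allₚ.map⁺ (All.tabulate (λ {r} _ → AllPairs⇒Linked (class-sorted r))) ,
      firsts-linked reps reps-sorted (λ m → m) ,
      pairwise⇒index-disjoint classes-disjoint ,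
      (λ x (1≤x , x≤N) → Anyₚ.map⁺ (lose (rep-of 1≤x x≤N) (∈-class⁺ 1≤x x≤N refl))) ,
      (λ x a → let (r , _ , x∈) = find (Anyₚ.map⁻ a) in proj₁ (∈-class⁻ x∈))
      where
      nonEmpty : ∀ {x : ℕ} {xs} → x ∈ xs → NonEmpty xs
      nonEmpty (here _)  = tt
      nonEmpty (there _) = tt

    same-class⇒ : ∀ {x y} → SameBlock classes x y → ρ x ≡ ρ y
    same-class⇒ s with find (Anyₚ.map⁻ s)
    ... | r , _ , x∈ , y∈ = trans (proj₂ (∈-class⁻ x∈)) (sym (proj₂ (∈-class⁻ y∈)))

    same-class⇐ : ∀ {x y} → 1 ≤ x → x ≤ N → 1 ≤ y → y ≤ N → ρ x ≡ ρ y → SameBlock classes x y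
    same-class⇐ 1≤x x≤N 1≤y y≤N ρx≡ρy =
      Anyₚ.map⁺ (lose (rep-of 1≤x x≤N) (∈-class⁺ 1≤x x≤N refl , ∈-class⁺ 1≤y y≤N (sym ρx≡ρy)))

    length-classes : length classes ≡ length reps
    length-classes = length-map class reps

    classes-size≥2 : (∀ {r} → r ∈ reps → Σ ℕ λ y → (1 ≤ y × y ≤ N) × ρ y ≡ r × y ≢ r) →
      All (λ B → 2 ≤ length B) classes
    classes-size≥2 mate = Allₚ.map⁺ (All.tabulate (λ {r} m →
      let (y , (1≤y , y≤N) , ρy≡r , y≢r) = mate m in two-members (∈-class⁺ 1≤y y≤N ρy≡r) (rep∈class m) y≢r))

  generated-unique : ∀ {N E P Q} → IsSetPartition N P → IsSetPartition N Q →
    Generates N E P → Generates N E Q → P ≡ Q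
  generated-unique spP spQ genP genQ =
    set-partition-unique spP spQ
      (λ x y 1≤x x≤N 1≤y y≤N s → proj₂ (genQ x y 1≤x x≤N 1≤y y≤N) (proj₁ (genP x y 1≤x x≤N 1≤y y≤N) s))
      (λ x y 1≤x x≤N 1≤y y≤N s → proj₂ (genP x y 1≤x x≤N 1≤y y≤N) (proj₁ (genQ x y 1≤x x≤N 1≤y y≤N) s))

  block-unique : ∀ {P B C x} → AllPairs Disjoint P → B ∈ P → C ∈ P → x ∈ B → x ∈ C → B ≡ C
  block-unique (_ ∷ _)  (here refl) (here refl) _ _ = refl
  block-unique (dB ∷ _) (here refl) (there C∈)  x∈B x∈C = ⊥-elim (All.lookup dB C∈ x∈B x∈C)
  block-unique (dC ∷ _) (there B∈)  (here refl) x∈B x∈C = ⊥-elim (All.lookup dC B∈ x∈C x∈B)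
  block-unique (_ ∷ dP) (there B∈)  (there C∈)  x∈B x∈C = block-unique dP B∈ C∈ x∈B x∈C

module VectorRows where

  open Defs using (StrictlyIncreasing)
  open SortedLists
  open import Data.Nat
  open import Data.Nat.Properties
  open import Data.List using (List; length)
  open import Data.List.Properties using (∷-injectiveˡ; ∷-injectiveʳ)
  open import Data.List.Membership.Propositional using (_∈_)
  open import Data.Fin using (Fin; zero; suc; toℕ; fromℕ<)
  open import Data.Fin.Properties using (toℕ-fromℕ<; toℕ<n)
  open import Data.Vec using (Vec; toList; fromList) renaming (lookup to vlookup; [] to v[]; _∷_ to _v∷_)
  open import Data.Vec.Properties using (length-toList; toList∘fromList)
  open import Data.Product using (Σ; _,_)
  open import Relation.Binary.PropositionalEquality

  -- Tableau rows are vectors; the proof works with the underlying lists.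
  lookup≡nth : ∀ {n} (v : Vec ℕ n) (j : Fin n) → vlookup v j ≡ nth (toList v) (toℕ j)
  lookup≡nth (x v∷ v) zero    = refl
  lookup≡nth (x v∷ v) (suc j) = lookup≡nth v j

  nth≡lookup : ∀ {n} (v : Vec ℕ n) j (j<n : j < n) → nth (toList v) j ≡ vlookup v (fromℕ< j<n)
  nth≡lookup v j j<n = sym (trans (lookup≡nth v (fromℕ< j<n)) (cong (nth (toList v)) (toℕ-fromℕ< j<n)))

  increasing⇒sorted : ∀ {n} (v : Vec ℕ n) → StrictlyIncreasing v → Sorted (toList v)
  increasing⇒sorted {n} v inc = nth-sorted (toList v) λ i j i<j j<len →
    let j<n = subst (j <_) (length-toList v) j<len ; i<n = <-trans i<j j<n in
    subst₂ _<_ (sym (nth≡lookup v i i<n)) (sym (nth≡lookup v j j<n))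
      (inc (fromℕ< i<n) (fromℕ< j<n) (subst₂ _<_ (sym (toℕ-fromℕ< i<n)) (sym (toℕ-fromℕ< j<n)) i<j))

  sorted⇒increasing : ∀ {n} (v : Vec ℕ n) → Sorted (toList v) → StrictlyIncreasing v
  sorted⇒increasing v s i j i<j =
    subst₂ _<_ (sym (lookup≡nth v i)) (sym (lookup≡nth v j))
      (sorted-nth s (toℕ i) (toℕ j) i<j (subst (toℕ j <_) (sym (length-toList v)) (toℕ<n j)))

  ∈-row⁻ : ∀ {n x} (v : Vec ℕ n) → x ∈ toList v → Σ (Fin n) λ j → vlookup v j ≡ x
  ∈-row⁻ v x∈ with ∈⇒nth (toList v) x∈
  ... | i , i<len , nth≡x = let i<n = subst (i <_) (length-toList v) i<len in
    fromℕ< i<n , trans (sym (nth≡lookup v i i<n)) nth≡x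

  ∈-row⁺ : ∀ {n} (v : Vec ℕ n) (j : Fin n) → vlookup v j ∈ toList v
  ∈-row⁺ v j = subst (_∈ toList v) (sym (lookup≡nth v j))
    (nth∈ (toList v) (toℕ j) (subst (toℕ j <_) (sym (length-toList v)) (toℕ<n j)))

  row-of-list : ∀ {n} (r : List ℕ) → length r ≡ n → Σ (Vec ℕ n) λ v → toList v ≡ r
  row-of-list r refl = fromList r , toList∘fromList r

  toList-injective : ∀ {n} (v w : Vec ℕ n) → toList v ≡ toList w → v ≡ w
  toList-injective v[]      v[]      _ = refl
  toList-injective (x v∷ v) (y v∷ w) e = cong₂ _v∷_ (∷-injectiveˡ e) (toList-injective v w (∷-injectiveʳ e))

module TableauToPartition where

  open SortedLists
  open GreedyPairing
  open Forests
  open Partitions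
  open VectorRows
  open import Data.Nat
  open import Data.Nat.Properties
  open import Data.List using (List; _∷_; length; map; filter)
  open import Data.List.Properties using (length-map; filter-≐)
  open import Data.List.Membership.Propositional using (_∈_; _∉_; find; lose)
  open import Data.List.Membership.Propositional.Properties using (∈-map⁻)
  open import Data.List.Membership.DecPropositional _≟_ using (_∈?_)
  open import Data.List.Relation.Unary.All as All using (All)
  open import Data.List.Relation.Unary.AllPairs using (_∷_)
  open import Data.List.Relation.Unary.Any as Any using (Any; here; there)
  open import Data.Fin using (Fin; fromℕ<)
  open import Data.Vec using (Vec; toList) renaming (lookup to vlookup)
  open import Data.Vec.Properties using (length-toList)
  open import Data.Maybe using (just)
  open import Data.Product using (Σ; _×_; _,_; proj₁; proj₂)
  open import Data.Sum using (_⊎_; inj₁; inj₂)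
  open import Data.Empty using (⊥; ⊥-elim)
  open import Relation.Nullary using (yes; no; ¬?)
  open import Relation.Binary using (tri<; tri≈; tri>)
  open import Relation.Binary.PropositionalEquality

  -- N = 2n - k = n + (n - k): row 2 has n entries, the rest are the block minima.
  ground-size : ∀ n k → k ≤ n → 2 * n ∸ k ≡ n + (n ∸ k)
  ground-size n k k≤n = trans (cong (_∸ k) (cong (n +_) (+-identityʳ n))) (+-∸-assoc n k≤n)

  LaterMate EarlierMate : ℕ → SetPartition → ℕ → Set
  LaterMate   N P x = (1 ≤ x × x ≤ N) × Σ ℕ λ y → x < y × y ≤ N × SameBlock P x y
  EarlierMate N P x = (1 ≤ x × x ≤ N) × Σ ℕ λ y → 1 ≤ y × y < x × SameBlock P x y

  module FromTableau (n k : ℕ) (k<n : k < n) (v1 v2 : Vec ℕ n) (inc : InInc k n (v1 , v2)) where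

    N : ℕ
    N = 2 * n ∸ k

    r1 r2 : List ℕ
    r1 = toList v1
    r2 = toList v2

    private
      increasing1 : StrictlyIncreasing v1
      increasing1 = proj₁ inc
      increasing2 : StrictlyIncreasing v2
      increasing2 = proj₁ (proj₂ inc)
      columns : (j : Fin n) → vlookup v1 j < vlookup v2 j
      columns = proj₁ (proj₂ (proj₂ inc))
      entries : (j : Fin n) → (1 ≤ vlookup v1 j × vlookup v1 j ≤ N) × (1 ≤ vlookup v2 j × vlookup v2 j ≤ N)
      entries = proj₁ (proj₂ (proj₂ (proj₂ inc)))
      covers : (m : ℕ) → 1 ≤ m → m ≤ N → (m ∈ r1) ⊎ (m ∈ r2)
      covers = proj₂ (proj₂ (proj₂ (proj₂ inc)))

    sorted1 : Sorted r1
    sorted1 = increasing⇒sorted v1 increasing1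
    sorted2 : Sorted r2
    sorted2 = increasing⇒sorted v2 increasing2

    ballot : ∀ j → j < n → nth r1 j < nth r2 j
    ballot j j<n = subst₂ _<_ (sym (nth≡lookup v1 j j<n)) (sym (nth≡lookup v2 j j<n)) (columns (fromℕ< j<n))

    range1 : ∀ {x} → x ∈ r1 → 1 ≤ x × x ≤ N
    range1 m with ∈-row⁻ v1 m
    ... | j , refl = proj₁ (entries j)
    range2 : ∀ {x} → x ∈ r2 → 1 ≤ x × x ≤ N
    range2 m with ∈-row⁻ v2 m
    ... | j , refl = proj₂ (entries j)

    -- The greedy pairing i ↦ p i = s_i of the row-2 entries.  It is kept
    -- opaque: only its greedy property matters.
    opaque
      p : ℕ → ℕ
      p = proj₁ (GreedyExists.greedy-run r1 r2 n sorted1 sorted2 (length-toList v1) (length-toList v2) ballot)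

    open Greedy r1 p

    opaque
      unfolding p
      greedy : IsGreedy r2
      greedy = run-from-r1⇒greedy r2 sorted2
        (proj₂ (GreedyExists.greedy-run r1 r2 n sorted1 sorted2 (length-toList v1) (length-toList v2) ballot))

    p∈r1 : ∀ {i} → i ∈ r2 → p i ∈ r1
    p∈r1 m = proj₁ (proj₁ (greedy _ m))
    p< : ∀ {i} → i ∈ r2 → p i < i
    p< m = proj₁ (proj₂ (greedy _ m))

    -- A value taken by i is no longer available to later entries.
    p-inj : ∀ {x y} → x ∈ r2 → y ∈ r2 → p x ≡ p y → x ≡ y
    p-inj {x} {y} x∈ y∈ px≡py with <-cmp x y
    ... | tri< x<y _ _ = ⊥-elim (proj₂ (proj₁ (greedy y y∈)) x x∈ x<y px≡py)
    ... | tri≈ _ x≡y _ = x≡y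
    ... | tri> _ _ y<x = ⊥-elim (proj₂ (proj₁ (greedy x x∈)) y y∈ y<x (sym px≡py))

    -- Both rows have n entries, so every row-1 entry is taken.
    p-onto : ∀ {y} → y ∈ r1 → Σ ℕ λ j → j ∈ r2 × p j ≡ y
    p-onto {y} y∈ with Any.any? (λ j → p j ≟ y) r2
    ... | yes some = find some
    ... | no none = ⊥-elim (<-irrefl refl (subst₂ _≤_ (cong suc (trans (length-map p r2) (length-toList v2))) (length-toList v1)
                      (distinct-⊆⇒length≤ (untaken ∷ map-distinct p (sorted⇒distinct sorted2) p-inj) ⊆r1)))
      where
      untaken : All (y ≢_) (map p r2)
      untaken = All.tabulate (λ z∈ y≡z → let (j , j∈ , z≡pj) = ∈-map⁻ p z∈ in none (lose j∈ (sym (trans y≡z z≡pj))))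
      ⊆r1 : ∀ {z} → z ∈ y ∷ map p r2 → z ∈ r1
      ⊆r1 (here refl) = y∈
      ⊆r1 (there z∈)  = let (j , j∈ , z≡pj) = ∈-map⁻ p z∈ in subst (_∈ r1) (sym z≡pj) (p∈r1 j∈)

    open ParentForest r2 p p<
    open Injective p-inj

    p-pos : ∀ {x} → x ∈ r2 → 1 ≤ p x
    p-pos m = proj₁ (range1 (p∈r1 m))

    -- π(T): the blocks are the trees of the forest i ↦ p i.
    open ClassPartition N root (λ {x} 1≤x _ → root-reach (1 ≤_) (λ y∈ _ → p-pos y∈) 1≤x , root-≤ x) (λ {x} _ _ → root-idem x)

    π : SetPartition
    π = classes

    pairing-edges : pairing (v1 , v2) ≡ just edges
    pairing-edges = greedy⇒pairing r2 sorted2 greedy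

    generates : Generates N edges π
    generates x y 1≤x x≤N 1≤y y≤N =
      (λ s → same-root⇒conn (same-class⇒ s)) , (λ c → same-class⇐ 1≤x x≤N 1≤y y≤N (conn⇒same-root c))

    -- Otherwise p v was available to u and exceeds p u, or b ≤ p v < p u.
    nested-edges : ∀ {b u v} → u ∈ r2 → v ∈ r2 → p u < b → b < u → p v < u → u < v →
      OnChain b v → root u ≢ root v → ⊥
    nested-edges {b} {u} {v} u∈ v∈ pu<b b<u pv<u u<v b↝v u≁v with <-cmp (p u) (p v)
    ... | tri< pu<pv _ _ = <-irrefl refl (<-≤-trans pu<pv (proj₂ (proj₂ (greedy u u∈)) (p v) pv-available pv<u))
      where
      pv-available : AvailableAt r2 u (p v)
      pv-available = p∈r1 v∈ , λ j j∈ j<u pj≡pv → <-irrefl (p-inj j∈ v∈ pj≡pv) (<-trans j<u u<v)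
    ... | tri≈ _ pu≡pv _ = u≁v (trans (root-parent u∈) (trans (cong root pu≡pv) (sym (root-parent v∈))))
    ... | tri> _ _ pv<pu =
      <-irrefl refl (<-≤-trans (<-trans pv<pu pu<b) (chain-≤ (proj₂ (chain-parent b↝v (<-trans b<u u<v)))))

    -- Trees do not cross: the chain a ↝ c has an edge (u , p u) over b, the
    -- chain b ↝ d an edge (v , p v) over u, and these are nested edges.
    trees-noncrossing : ∀ a b c d → a < b → b < c → c < d →
      root a ≡ root c → root b ≡ root d → root a ≢ root b → ⊥
    trees-noncrossing a b c d a<b b<c c<d a~c b~d a≁b
      with straddle (chain a~c (<⇒≤ (<-trans a<b b<c))) a<b b<c (λ b~c → a≁b (trans a~c (sym b~c)))
    ... | u , u∈ , pu<b , b<u , u~c , u≤c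
      with straddle (chain b~d (<⇒≤ (<-trans b<c c<d))) b<u (≤-<-trans u≤c c<d)
             (λ u~d → a≁b (trans a~c (trans (sym u~c) (trans u~d (sym b~d)))))
    ... | v , v∈ , pv<u , u<v , v~d , _ =
      nested-edges u∈ v∈ pu<b b<u pv<u u<v (chain (trans b~d (sym v~d)) (<⇒≤ (<-trans b<u u<v)))
        (λ u~v → a≁b (trans a~c (trans (sym u~c) (trans u~v (trans v~d (sym b~d))))))

    π-noncrossing : Noncrossing π
    π-noncrossing = noncrossingRel⇒noncrossing π (blocks-disjoint classes-partition) nc
      where
      open SameBlockEquivalence classes-partition
      nc : NoncrossingRel π
      nc a b c d a<b b<c c<d ac bd a≁b =
        let (1≤a , a≤N) = inside-left ac ; (1≤b , b≤N) = inside-left bd in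
        trees-noncrossing a b c d a<b b<c c<d (same-class⇒ ac) (same-class⇒ bd)
          (λ e → a≁b (same-class⇐ 1≤a a≤N 1≤b b≤N e))

    root-fixed⇔∉r2 : ∀ x → (root x ≡ x → x ∉ r2) × (x ∉ r2 → root x ≡ x)
    root-fixed⇔∉r2 x = (λ fixed x∈ → <-irrefl fixed (≤-<-trans (≤-trans (≤-reflexive (root-parent x∈)) (root-≤ (p x))) (p< x∈))) ,
                       root-of-root

    length-reps : length reps ≡ n ∸ k
    length-reps = +-cancelˡ-≡ n _ _ (begin
      n + length reps                                          ≡⟨ cong (_+ length reps) (sym (length-toList v2)) ⟩
      length r2 + length reps                                  ≡⟨ cong (λ l → length r2 + length l) (sym reps≡outside) ⟩
      length r2 + length (filter (λ y → ¬? (y ∈? r2)) (range N)) ≡⟨ length-complement N sorted2 range2 ⟩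
      N                                                        ≡⟨ ground-size n k (<⇒≤ k<n) ⟩
      n + (n ∸ k)                                              ∎)
      where
      open ≡-Reasoning
      reps≡outside : filter (λ y → ¬? (y ∈? r2)) (range N) ≡ reps
      reps≡outside = filter-≐ (λ y → ¬? (y ∈? r2)) isRep? ((λ {x} → proj₂ (root-fixed⇔∉r2 x)) , λ {x} → proj₁ (root-fixed⇔∉r2 x)) (range N)

    -- A root r is in row 1, hence r = p j for some j in its tree.
    π-size≥2 : All (λ B → 2 ≤ length B) π
    π-size≥2 = classes-size≥2 λ {r} m →
      let ((1≤r , r≤N) , root≡r) = ∈-reps⁻ m ; r∉r2 = proj₁ (root-fixed⇔∉r2 r) root≡r in
      mate r 1≤r r≤N root≡r r∉r2
      where
      mate : ∀ r → 1 ≤ r → r ≤ N → root r ≡ r → r ∉ r2 → Σ ℕ λ y → (1 ≤ y × y ≤ N) × root y ≡ r × y ≢ r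
      mate r 1≤r r≤N root≡r r∉r2 with covers r 1≤r r≤N
      ... | inj₂ r∈r2 = ⊥-elim (r∉r2 r∈r2)
      ... | inj₁ r∈r1 with p-onto r∈r1
      ...   | j , j∈ , pj≡r = j , range2 j∈ , trans (root-parent j∈) (trans (cong root pj≡r) root≡r) ,
                             λ j≡r → r∉r2 (subst (_∈ r2) j≡r j∈)

    π-image : InNC N (n ∸ k) π
    π-image = classes-partition , π-noncrossing , trans length-classes length-reps , π-size≥2

    π-related : PiRel k n (v1 , v2) π
    π-related = classes-partition , edges , pairing-edges , generates

    -- The rows are recovered from any partition P generated by the pairing:
    -- row 1 = points with a larger blockmate, row 2 = points with a smaller one.
    module Rows (P : SetPartition) (gen : Generates N edges P) where

      row1⇒ : ∀ {x} → x ∈ r1 → LaterMate N P x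
      row1⇒ {x} x∈ with p-onto x∈
      ... | j , j∈ , refl = range1 x∈ , j , p< j∈ , proj₂ (range2 j∈) ,
        proj₂ (gen (p j) j (proj₁ (range1 x∈)) (proj₂ (range1 x∈)) (proj₁ (range2 j∈)) (proj₂ (range2 j∈))) (c-sym (c-edge (edge j∈)))

      row1⇐ : ∀ {x} → LaterMate N P x → x ∈ r1
      row1⇐ {x} ((1≤x , x≤N) , y , x<y , y≤N , s)
        with chain-child (chain (conn⇒same-root (proj₁ (gen x y 1≤x x≤N (≤-trans 1≤x (<⇒≤ x<y)) y≤N) s)) (<⇒≤ x<y)) x<y
      ... | z , z∈ , pz≡x , _ = subst (_∈ r1) pz≡x (p∈r1 z∈)

      row2⇒ : ∀ {x} → x ∈ r2 → EarlierMate N P x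
      row2⇒ {x} x∈ = range2 x∈ , p x , proj₁ (range1 (p∈r1 x∈)) , p< x∈ ,
        proj₂ (gen x (p x) (proj₁ (range2 x∈)) (proj₂ (range2 x∈)) (proj₁ (range1 (p∈r1 x∈))) (proj₂ (range1 (p∈r1 x∈)))) (c-edge (edge x∈))

      row2⇐ : ∀ {x} → EarlierMate N P x → x ∈ r2
      row2⇐ {x} ((1≤x , x≤N) , y , 1≤y , y<x , s) with x ∈? r2
      ... | yes x∈ = x∈
      ... | no x∉ = ⊥-elim (<-irrefl refl (≤-<-trans root-x≤y y<x))
        where
        root-x≤y : x ≤ y
        root-x≤y = subst (_≤ y) (trans (sym (conn⇒same-root (proj₁ (gen x y 1≤x x≤N 1≤y (≤-trans (<⇒≤ y<x) x≤N)) s))) (root-of-root x∉))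
                     (root-≤ y)

module PartitionToTableau where

  open SortedLists
  open GreedyPairing
  open Forests
  open Partitions
  open VectorRows
  open TableauToPartition using (ground-size)
  open import Data.Nat
  open import Data.Nat.Properties
  open import Data.List using (List; length; map; filter; take)
  open import Data.List.Properties using (length-map)
  open import Data.List.Membership.Propositional using (_∈_; find; lose)
  open import Data.List.Membership.Propositional.Properties using (∈-filter⁺; ∈-filter⁻; ∈-map⁺; ∈-map⁻)
  open import Data.List.Membership.DecPropositional _≟_ using (_∈?_)
  open import Data.List.Relation.Unary.All as All using (All)
  open import Data.List.Relation.Unary.Any as Any using (Any)
  open import Data.List.Relation.Unary.AllPairs using (AllPairs)
  open import Data.List.Relation.Unary.AllPairs.Properties as AllPairsₚ using ()
  open import Data.Fin using (toℕ)
  open import Data.Fin.Properties using (toℕ<n)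
  open import Data.Vec using (Vec; toList) renaming (lookup to vlookup)
  open import Data.Maybe using (just; nothing; fromMaybe)
  open import Data.Product using (Σ; _×_; _,_; proj₁; proj₂)
  open import Data.Sum using (_⊎_; inj₁; inj₂) renaming (map to ⊎-map)
  open import Data.Empty using (⊥-elim)
  open import Relation.Nullary using (¬_; Dec; yes; no; ¬?)
  open import Relation.Nullary.Decidable using (_×-dec_)
  open import Relation.Binary using (tri<; tri≈; tri>)
  open import Relation.Binary.PropositionalEquality

  module FromPartition (n k : ℕ) (k<n : k < n) (P : SetPartition) (target : InNC (2 * n ∸ k) (n ∸ k) P) where

    N : ℕ
    N = 2 * n ∸ k

    private
      partition : IsSetPartition N P
      partition = proj₁ target
      noncrossing : NoncrossingRel P
      noncrossing = noncrossing⇒noncrossingRel P (proj₁ (proj₂ target))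
      block-count : length P ≡ n ∸ k
      block-count = proj₁ (proj₂ (proj₂ target))
      big-blocks : All (λ B → 2 ≤ length B) P
      big-blocks = proj₂ (proj₂ (proj₂ target))
      canonical : Canonical P
      canonical = set-partition⇒canonical partition

    open SameBlockEquivalence partition

    Same : ℕ → ℕ → Set
    Same = SameBlock P

    same? : ∀ x y → Dec (Same x y)
    same? x y = Any.any? (λ B → (x ∈? B) ×-dec (y ∈? B)) P

    Later Earlier : ℕ → Set
    Later   x = Any (λ y → x < y × Same x y) (range N)
    Earlier x = Any (λ y → y < x × Same x y) (range N)

    later? : ∀ x → Dec (Later x)
    later?   x = Any.any? (λ y → (x <? y) ×-dec same? x y) (range N)
    earlier? : ∀ x → Dec (Earlier x)
    earlier? x = Any.any? (λ y → (y <? x) ×-dec same? x y) (range N)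

    r1 r2 : List ℕ
    r1 = filter later? (range N)
    r2 = filter earlier? (range N)

    sorted1 : Sorted r1
    sorted1 = AllPairsₚ.filter⁺ later? (range-sorted N)
    sorted2 : Sorted r2
    sorted2 = AllPairsₚ.filter⁺ earlier? (range-sorted N)

    mate∈range : ∀ {x y} → Same x y → y ∈ range N
    mate∈range s = let (1≤y , y≤N) = inside-right s in ∈-range⁺ 1≤y y≤N

    ∈-r1⁺ : ∀ {x y} → x < y → Same x y → x ∈ r1
    ∈-r1⁺ x<y s = let (1≤x , x≤N) = inside-left s ; (1≤y , y≤N) = inside-right s in
      ∈-filter⁺ later? (∈-range⁺ 1≤x x≤N) (lose (∈-range⁺ 1≤y y≤N) (x<y , s))
    ∈-r2⁺ : ∀ {x y} → y < x → Same x y → x ∈ r2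
    ∈-r2⁺ y<x s = let (1≤x , x≤N) = inside-left s ; (1≤y , y≤N) = inside-right s in
      ∈-filter⁺ earlier? (∈-range⁺ 1≤x x≤N) (lose (∈-range⁺ 1≤y y≤N) (y<x , s))

    ∈-r1⁻ : ∀ {x} → x ∈ r1 → Σ ℕ λ y → x < y × Same x y
    ∈-r1⁻ m = let (y , _ , mate) = find (proj₂ (∈-filter⁻ later? {xs = range N} m)) in y , mate
    ∈-r2⁻ : ∀ {x} → x ∈ r2 → Σ ℕ λ y → y < x × Same x y
    ∈-r2⁻ m = let (y , _ , mate) = find (proj₂ (∈-filter⁻ earlier? {xs = range N} m)) in y , mate

    range1 : ∀ {x} → x ∈ r1 → 1 ≤ x × x ≤ N
    range1 m = ∈-range⁻ (proj₁ (∈-filter⁻ later? {xs = range N} m))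
    range2 : ∀ {x} → x ∈ r2 → 1 ≤ x × x ≤ N
    range2 m = ∈-range⁻ (proj₁ (∈-filter⁻ earlier? {xs = range N} m))

    mates : ℕ → List ℕ
    mates x = filter (same? x) (range N)

    ∈-mates⁺ : ∀ {x y} → Same x y → y ∈ mates x
    ∈-mates⁺ s = let (1≤y , y≤N) = inside-right s in ∈-filter⁺ (same? _) (∈-range⁺ 1≤y y≤N) s

    ∈-mates⁻ : ∀ {x y} → y ∈ mates x → Same x y
    ∈-mates⁻ m = proj₂ (∈-filter⁻ (same? _) {xs = range N} m)

    prev : ℕ → ℕ
    prev x = fromMaybe 0 (largestBelow x (mates x))

    laterMates : ℕ → List ℕ
    laterMates x = filter (x <?_) (mates x)

    next : ℕ → ℕ
    next x = head0 (laterMates x)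

    prev-spec : ∀ {x} → x ∈ r2 → MaxBelow (Same x) x (prev x)
    prev-spec {x} x∈ = from-spec (largestBelow x (mates x)) (largestBelow-spec x (mates x))
      where
      from-spec : ∀ r → LargestBelowSpec x (mates x) r → MaxBelow (Same x) x (fromMaybe 0 r)
      from-spec nothing none = let (y , y<x , s) = ∈-r2⁻ x∈ in ⊥-elim (none y (∈-mates⁺ s) y<x)
      from-spec (just s) (s∈ , s<x , max) = ∈-mates⁻ s∈ , s<x , λ y s' y<x → max y (∈-mates⁺ s') y<x

    prev< : ∀ {x} → x ∈ r2 → prev x < x
    prev< m = proj₁ (proj₂ (prev-spec m))
    prev-same : ∀ {x} → x ∈ r2 → Same x (prev x)
    prev-same m = proj₁ (prev-spec m)
    prev-max : ∀ {x y} → x ∈ r2 → y < x → Same x y → y ≤ prev x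
    prev-max m y<x s = proj₂ (proj₂ (prev-spec m)) _ s y<x

    private
      laterMates-sorted : ∀ x → Sorted (laterMates x)
      laterMates-sorted x = AllPairsₚ.filter⁺ (x <?_) (AllPairsₚ.filter⁺ (same? x) (range-sorted N))

      ∈-laterMates : ∀ {x y} → x < y → Same x y → y ∈ laterMates x
      ∈-laterMates x<y s = ∈-filter⁺ (_ <?_) (∈-mates⁺ s) x<y

    next-spec : ∀ {x} → x ∈ r1 → x < next x × Same x (next x)
    next-spec {x} x∈ =
      let (y , x<y , s) = ∈-r1⁻ x∈
          (m , x<) = ∈-filter⁻ (x <?_) {xs = mates x} (member⇒head∈ (∈-laterMates x<y s))
      in x< , ∈-mates⁻ m

    next-min : ∀ {x y} → x < y → Same x y → next x ≤ y
    next-min {x} x<y s = head≤ (laterMates-sorted x) (∈-laterMates x<y s)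

    prev∈r1 : ∀ {x} → x ∈ r2 → prev x ∈ r1
    prev∈r1 m = ∈-r1⁺ (prev< m) (same-sym (prev-same m))

    next∈r2 : ∀ {x} → x ∈ r1 → next x ∈ r2
    next∈r2 m = let (x< , s) = next-spec m in ∈-r2⁺ x< (same-sym s)

    private
      prev-inj< : ∀ {x y} → x ∈ r2 → y ∈ r2 → x < y → prev x ≢ prev y
      prev-inj< x∈ y∈ x<y e =
        <-irrefl refl (<-≤-trans (subst (_< _) e (prev< x∈))
          (prev-max y∈ x<y (same-trans (prev-same y∈) (same-sym (subst (Same _) e (prev-same x∈))))))

      next-inj< : ∀ {x y} → x ∈ r1 → y ∈ r1 → x < y → next x ≢ next y
      next-inj< x∈ y∈ x<y e = <-irrefl refl (≤-<-trans
        (next-min x<y (same-trans (proj₂ (next-spec x∈)) (same-sym (subst (Same _) (sym e) (proj₂ (next-spec y∈))))))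
        (subst (_ <_) (sym e) (proj₁ (next-spec y∈))))

    prev-inj : ∀ {x y} → x ∈ r2 → y ∈ r2 → prev x ≡ prev y → x ≡ y
    prev-inj {x} {y} x∈ y∈ e with <-cmp x y
    ... | tri< x<y _ _ = ⊥-elim (prev-inj< x∈ y∈ x<y e)
    ... | tri≈ _ x≡y _ = x≡y
    ... | tri> _ _ y<x = ⊥-elim (prev-inj< y∈ x∈ y<x (sym e))

    next-inj : ∀ {x y} → x ∈ r1 → y ∈ r1 → next x ≡ next y → x ≡ y
    next-inj {x} {y} x∈ y∈ e with <-cmp x y
    ... | tri< x<y _ _ = ⊥-elim (next-inj< x∈ y∈ x<y e)
    ... | tri≈ _ x≡y _ = x≡y
    ... | tri> _ _ y<x = ⊥-elim (next-inj< y∈ x∈ y<x (sym e))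

    -- y is the largest blockmate below next y: a larger one would precede next y.
    prev-next : ∀ {y} → y ∈ r1 → prev (next y) ≡ y
    prev-next {y} y∈ with m≤n⇒m<n∨m≡n (prev-max (next∈r2 y∈) (proj₁ (next-spec y∈)) (same-sym (proj₂ (next-spec y∈))))
    ... | inj₂ y≡ = sym y≡
    ... | inj₁ y<prev = ⊥-elim (<-irrefl refl (≤-<-trans
            (next-min y<prev (same-trans (proj₂ (next-spec y∈)) (prev-same (next∈r2 y∈)))) (prev< (next∈r2 y∈))))

    -- Counting: the points without a smaller blockmate are the block minima,
    -- so row 2 has N - (n - k) = n entries; prev and next are injections
    -- between the rows, so row 1 has n entries too.
    minima : List ℕ
    minima = map head0 P

    private
      nonempty-blocks : All NonEmpty P
      nonempty-blocks = proj₁ canonical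
      sorted-blocks : All Sorted P
      sorted-blocks = proj₁ (proj₂ canonical)
      minima-ordered : AllPairs (λ B C → head0 B < head0 C) P
      minima-ordered = proj₁ (proj₂ (proj₂ canonical))
      disjoint-blocks : AllPairs Disjoint P
      disjoint-blocks = proj₂ (proj₂ (proj₂ canonical))

    not-earlier≡minima : filter (λ x → ¬? (earlier? x)) (range N) ≡ minima
    not-earlier≡minima = sorted-ext (AllPairsₚ.filter⁺ (λ x → ¬? (earlier? x)) (range-sorted N)) (AllPairsₚ.map⁺ minima-ordered) to from
      where
      to : ∀ {x} → x ∈ filter (λ x → ¬? (earlier? x)) (range N) → x ∈ minima
      to {x} m with ∈-filter⁻ (λ x → ¬? (earlier? x)) {xs = range N} m
      ... | x∈range , not-earlier with find (blocks-cover partition _ (∈-range⁻ x∈range))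
      ...   | B , B∈ , x∈B with m≤n⇒m<n∨m≡n (head≤ (All.lookup sorted-blocks B∈) x∈B)
      ...     | inj₂ first≡x = subst (_∈ minima) first≡x (∈-map⁺ head0 B∈)
      ...     | inj₁ first<x = ⊥-elim (not-earlier (lose (mate∈range s) (first<x , s)))
        where
        s : Same x (head0 B)
        s = lose B∈ (x∈B , head∈ (All.lookup nonempty-blocks B∈))
      from : ∀ {x} → x ∈ minima → x ∈ filter (λ x → ¬? (earlier? x)) (range N)
      from m with ∈-map⁻ head0 m
      ... | B , B∈ , refl = ∈-filter⁺ (λ x → ¬? (earlier? x)) (mate∈range (same-refl′ f∈B)) not-earlier
        where
        f∈B : head0 B ∈ B
        f∈B = head∈ (All.lookup nonempty-blocks B∈)
        same-refl′ : ∀ {x} → x ∈ B → Same x x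
        same-refl′ x∈B = lose B∈ (x∈B , x∈B)
        not-earlier : ¬ Earlier (head0 B)
        not-earlier e with find e
        ... | y , _ , y<f , s with find s
        ...   | C , C∈ , f∈C , y∈C with block-unique disjoint-blocks B∈ C∈ f∈B f∈C
        ...     | refl = <-irrefl refl (<-≤-trans y<f (head≤ (All.lookup sorted-blocks B∈) y∈C))

    length-r2 : length r2 ≡ n
    length-r2 = +-cancelʳ-≡ (n ∸ k) (length r2) n (begin
      length r2 + (n ∸ k)                                   ≡⟨ cong (length r2 +_) (sym (trans (length-map head0 P) block-count)) ⟩
      length r2 + length minima                             ≡⟨ cong (λ l → length r2 + length l) (sym not-earlier≡minima) ⟩
      length r2 + length (filter (λ x → ¬? (earlier? x)) (range N)) ≡⟨ length-filter-split earlier? (range N) ⟩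
      length (range N)                                      ≡⟨ length-range N ⟩
      N                                                     ≡⟨ ground-size n k (<⇒≤ k<n) ⟩
      n + (n ∸ k)                                           ∎)
      where open ≡-Reasoning

    length-r1 : length r1 ≡ n
    length-r1 = ≤-antisym
      (subst (length r1 ≤_) length-r2 (injection⇒length≤ next (sorted⇒distinct sorted1) next-inj next∈r2))
      (subst (_≤ length r1) length-r2 (injection⇒length≤ prev (sorted⇒distinct sorted2) prev-inj prev∈r1))

    -- Column condition: if r2[j] ≤ r1[j], then prev would map the first j+1
    -- entries of row 2 injectively into the first j entries of row 1.
    private
      prev-into-prefix : ∀ {j w} → j < n → nth r2 j ≤ nth r1 j → w ∈ take (suc j) r2 → prev w ∈ take j r1
      prev-into-prefix {j} j<n r2≤r1 w∈ with ∈take⇒nth (suc j) r2 w∈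
      ... | j' , s≤s j'≤j , _ , refl with ∈⇒nth r1 (prev∈r1 (take⊆ (suc j) r2 w∈))
      ...   | j'' , j''< , nth≡prev with j'' <? j
      ...     | yes j''<j = subst (_∈ take j r1) nth≡prev (nth∈take j r1 j'' j''<j j''<)
      ...     | no j''≮j = ⊥-elim (<-irrefl refl (<-≤-trans (prev< (take⊆ (suc j) r2 w∈)) (begin
                 nth r2 j'  ≤⟨ sorted-nth≤ sorted2 j' j j'≤j (subst (j <_) (sym length-r2) j<n) ⟩
                 nth r2 j   ≤⟨ r2≤r1 ⟩
                 nth r1 j   ≤⟨ sorted-nth≤ sorted1 j j'' (≮⇒≥ j''≮j) j''< ⟩
                 nth r1 j'' ≡⟨ nth≡prev ⟩
                 prev (nth r2 j') ∎)))
        where open ≤-Reasoning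

    ballot : ∀ j → j < n → nth r1 j < nth r2 j
    ballot j j<n with nth r1 j <? nth r2 j
    ... | yes r1<r2 = r1<r2
    ... | no r1≮r2 = ⊥-elim (<-irrefl refl (≤-trans too-many (length-take≤ j r1)))
      where
      too-many : suc j ≤ length (take j r1)
      too-many = subst (_≤ length (take j r1)) (length-take-exact (suc j) r2 (subst (j <_) (sym length-r2) j<n))
        (injection⇒length≤ prev (AllPairsₚ.take⁺ (suc j) (sorted⇒distinct sorted2))
          (λ x∈ y∈ → prev-inj (take⊆ (suc j) r2 x∈) (take⊆ (suc j) r2 y∈))
          (prev-into-prefix j<n (≮⇒≥ r1≮r2)))

    private
      row1 : Σ (Vec ℕ n) λ v → toList v ≡ r1
      row1 = row-of-list r1 length-r1
      row2 : Σ (Vec ℕ n) λ v → toList v ≡ r2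
      row2 = row-of-list r2 length-r2

    v1 v2 : Vec ℕ n
    v1 = proj₁ row1
    v2 = proj₁ row2

    toList-v1 : toList v1 ≡ r1
    toList-v1 = proj₂ row1
    toList-v2 : toList v2 ≡ r2
    toList-v2 = proj₂ row2

    private
      lookup1 : ∀ j → vlookup v1 j ≡ nth r1 (toℕ j)
      lookup1 j = trans (lookup≡nth v1 j) (cong (λ r → nth r (toℕ j)) toList-v1)
      lookup2 : ∀ j → vlookup v2 j ≡ nth r2 (toℕ j)
      lookup2 j = trans (lookup≡nth v2 j) (cong (λ r → nth r (toℕ j)) toList-v2)

      -- every point of [1..N] has a blockmate, smaller or larger
      in-some-row : (m : ℕ) → 1 ≤ m → m ≤ N → (m ∈ r1) ⊎ (m ∈ r2)
      in-some-row m 1≤m m≤N with find (blocks-cover partition m (1≤m , m≤N))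
      ... | B , B∈ , m∈B with another-member (sorted⇒distinct (All.lookup sorted-blocks B∈)) (All.lookup big-blocks B∈) m∈B
      ...   | y , y∈B , y≢m with <-cmp y m
      ...     | tri< y<m _ _ = inj₂ (∈-r2⁺ y<m (lose B∈ (m∈B , y∈B)))
      ...     | tri≈ _ y≡m _ = ⊥-elim (y≢m y≡m)
      ...     | tri> _ _ m<y = inj₁ (∈-r1⁺ m<y (lose B∈ (m∈B , y∈B)))

    tableau : InInc k n (v1 , v2)
    tableau =
      sorted⇒increasing v1 (subst Sorted (sym toList-v1) sorted1) ,
      sorted⇒increasing v2 (subst Sorted (sym toList-v2) sorted2) ,
      (λ j → subst₂ _<_ (sym (lookup1 j)) (sym (lookup2 j)) (ballot (toℕ j) (toℕ<n j))) ,
      (λ j → range1 (subst (vlookup v1 j ∈_) toList-v1 (∈-row⁺ v1 j)) , range2 (subst (vlookup v2 j ∈_) toList-v2 (∈-row⁺ v2 j))) ,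
      (λ m 1≤m m≤N → ⊎-map (subst (m ∈_) (sym toList-v1)) (subst (m ∈_) (sym toList-v2)) (in-some-row m 1≤m m≤N))

    -- prev is the greedy pairing: a larger free value y below i would have its
    -- next blockmate before i (contradicting freeness), at i (contradicting
    -- maximality of prev i), or after i (a crossing with the block of i).
    open Greedy r1 prev

    prev-greedy : IsGreedy r2
    prev-greedy i i∈ = (prev∈r1 i∈ , λ j j∈ j<i e → <-irrefl (prev-inj j∈ i∈ e) j<i) , prev< i∈ , maximal
      where
      maximal : ∀ y → AvailableAt r2 i y → y < i → y ≤ prev i
      maximal y (y∈ , free) y<i with y ≤? prev i
      ... | yes y≤ = y≤
      ... | no y≰ with next-spec y∈ | <-cmp (next y) i
      ...   | _ , y~next | tri< next<i _ _ = ⊥-elim (free (next y) (next∈r2 y∈) next<i (prev-next y∈))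
      ...   | _ , y~next | tri≈ _ next≡i _ = ⊥-elim (y≰ (prev-max i∈ y<i (same-sym (subst (Same y) next≡i y~next))))
      ...   | _ , y~next | tri> _ _ i<next =
        ⊥-elim (noncrossing (prev i) y i (next y) (≰⇒> y≰) y<i i<next (same-sym (prev-same i∈)) y~next
          (λ s → y≰ (prev-max i∈ y<i (same-trans (prev-same i∈) s))))

    open ParentForest r2 prev prev<

    pairing-edges : pairing (v1 , v2) ≡ just edges
    pairing-edges = subst₂ (λ a b → pairingFrom a b ≡ just edges) (sym toList-v1) (sym toList-v2)
      (greedy⇒pairing r2 sorted2 prev-greedy)

    same-root : ∀ {x y} → Same x y → Same x (root x)
    same-root s = root-reach (Same _) (λ y∈ s' → same-trans s' (prev-same y∈)) (same-trans s (same-sym s))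

    -- Distinct roots are not in row 2, so they lie in different blocks.
    same⇒same-root : ∀ {x y} → Same x y → root x ≡ root y
    same⇒same-root {x} {y} s with <-cmp (root x) (root y)
    ... | tri≈ _ e _ = e
    ... | tri< rx<ry _ _ = ⊥-elim (root-∉ y (∈-r2⁺ rx<ry (same-trans (same-sym (same-root (same-sym s))) (same-trans (same-sym s) (same-root s)))))
    ... | tri> _ _ ry<rx = ⊥-elim (root-∉ x (∈-r2⁺ ry<rx (same-trans (same-sym (same-root s)) (same-trans s (same-root (same-sym s))))))

    generates : Generates N edges P
    generates x y 1≤x x≤N 1≤y y≤N =
      (λ s → same-root⇒conn (same⇒same-root s)) ,
      (λ c → same-trans (same-root (same-refl 1≤x x≤N))
               (subst (λ z → Same z y) (sym (conn⇒same-root c)) (same-sym (same-root (same-refl 1≤y y≤N)))))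

    π-related : PiRel k n (v1 , v2) P
    π-related = partition , edges , pairing-edges , generates

open SortedLists using (sorted-ext)
open Partitions using (generated-unique)
open VectorRows using (toList-injective)
open TableauToPartition using (module FromTableau)
open PartitionToTableau using (module FromPartition)
open import Data.Maybe.Properties using (just-injective)
open import Data.Product using (_,_)
open import Relation.Binary.PropositionalEquality

-- π(T) is determined by T: the pairing is a function of T and the
-- partition it generates is unique.
π-functional : ∀ {k n T P P'} → PiRel k n T P → PiRel k n T P' → P ≡ P'
π-functional (spP , E , pairing≡E , genP) (spP' , E' , pairing≡E' , genP')
  with just-injective (trans (sym pairing≡E) pairing≡E')
... | refl = generated-unique spP spP' genP genP'

-- T is determined by π(T): row 1 (row 2) consists of the points having a
-- larger (smaller) blockmate.
π-injective : ∀ n k → k < n → (T T' : Tab n) (P : SetPartition) →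
  InInc k n T → InInc k n T' → PiRel k n T P → PiRel k n T' P → T ≡ T'
π-injective n k k<n (v1 , v2) (w1 , w2) P inc inc' (_ , E , pairing≡E , gen) (_ , E' , pairing≡E' , gen') =
  cong₂ _,_
    (toList-injective v1 w1 (sorted-ext T.sorted1 T'.sorted1 (λ m → R'.row1⇐ (R.row1⇒ m)) (λ m → R.row1⇐ (R'.row1⇒ m))))
    (toList-injective v2 w2 (sorted-ext T.sorted2 T'.sorted2 (λ m → R'.row2⇐ (R.row2⇒ m)) (λ m → R.row2⇐ (R'.row2⇒ m))))
  where
  module T  = FromTableau n k k<n v1 v2 inc
  module T' = FromTableau n k k<n w1 w2 inc'
  module R  = T.Rows  P (subst (λ e → Generates T.N e P) (just-injective (trans (sym pairing≡E) T.pairing-edges)) gen)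
  module R' = T'.Rows P (subst (λ e → Generates T'.N e P) (just-injective (trans (sym pairing≡E') T'.pairing-edges)) gen')

proposition2p3 : (n k : ℕ) → 1 ≤ n → k < n →
    IsBijectionRel (InInc k n) (InNC (2 * n ∸ k) (n ∸ k)) (PiRel k n)
proposition2p3 n k _ k<n = record
  { total      = λ (v1 , v2) inc → let open FromTableau n k k<n v1 v2 inc in π , π-image , π-related
  ; functional = λ T P P' _ → π-functional {k} {n} {T} {P} {P'}
  ; injective  = π-injective n k k<n
  ; surjective = λ P target → let open FromPartition n k k<n P target in (v1 , v2) , tableau , π-related
  }
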